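{- Let $n\ge 3$ and let $A$ be the symmetric $n\times n$ matrix (diagonal entries irrelevant) defined by $A_{1n}=0$; $A_{1i}=1$ for $2\le i\le n-1$; $A_{2n}=1$; $A_{in}=2$ for $3\le i\le n-1$; and $A_{ij}=A_{i-1,j+1}+1$ for $2\le i<j\le n-1$. Let $\sigma_0=(2,3,\dots,n,1)$ and $\sigma_i=\mathrm{SFS}_+(A,\sigma_{i-1})$ for $1\le i\le n-2$. Then the smallest index $j$ for which $\sigma_j$ is a Robinson ordering of $A$ is $j=n-2$.
   Context: A linear order $\pi$ of $V=[n]$ is a Robinson ordering of $A$ if $A_{xz}\le\min\{A_{xy},A_{yz}\}$ for all $x<_\pi y<_\pi z$. Similarity partition: for $p\in V$ and $U\subseteq V\setminus\{p\}$, let $N_U(p)=\{y\in U:A_{py}>0\}$, let $a_1>\dots>a_s>0$ be the distinct values $A_{py}$, $y\in N_U(p)$, and $C_i=\{y\in N_U(p):A_{py}=a_i\}$; the similarity partition is $(C_1,\dots,C_s)$. Refining an ordered partition $(B_1,\dots,B_r)$ of $U$ by $(C_1,\dots,C_s)$ replaces each $B_j$ by $(B_j\cap C_1,\dots,B_j\cap C_s,B_j\setminus(C_1\cup\dots\cup C_s))$ and deletes empty classes. $\mathrm{SFS}_+(A,\tau)$ for a linear order $\tau$ of $V$: start with queue $\phi=(V)$. For $i=1,\dots,n$: let $S$ be the first class of $\phi$; choose as pivot $p$ the element of $S$ appearing last in $\tau$; put $p$ at position $i$ of the output order; remove $p$ from $\phi$; with $U$ the set of vertices remaining in $\phi$,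 refine $\phi$ by the similarity partition of $N_U(p)$. Output the resulting linear order. -}

module Defs where

open import Data.Nat using (ℕ; zero; suc; _≤_; _<ᵇ_; _≡ᵇ_; _⊓_; _⊔_; _∸_)
open import Data.Bool using (Bool; true; false; if_then_else_; not; _∧_)
open import Data.List using (List; []; _∷_; _++_; concat; map; filterᵇ; upTo; downFrom; length; lookup; foldr)
open import Data.Fin as Fin using (Fin)
open import Data.Bool.ListAction using (any)

-- Vertices are the natural numbers 1..n; linear orders are lists of vertices.

Aup : ℕ → ℕ → ℕ → ℕ
Aup n zero j = 0            -- unused (index 0 is not a vertex)
Aup n (suc zero) j = if j ≡ᵇ n then 0 else 1
Aup n (suc (suc i)) j =
  if j ≡ᵇ n
  then (if i ≡ᵇ 0 then 1 else 2)
  else suc (Aup n (suc i) (suc j))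

-- The symmetric matrix A; the diagonal is irrelevant (never used) and set to 0.
A : ℕ → ℕ → ℕ → ℕ
A n i j = if i <ᵇ j then Aup n i j else (if j <ᵇ i then Aup n j i else 0)

Robinson : ℕ → List ℕ → Set
Robinson n π = (a b c : Fin (length π)) → a Fin.< b → b Fin.< c →
  A n (lookup π a) (lookup π c) ≤ (A n (lookup π a) (lookup π b) ⊓ A n (lookup π b) (lookup π c))

-- position of x in a list (0-based; length if absent)
pos : List ℕ → ℕ → ℕ
pos [] x = 0
pos (y ∷ ys) x = if y ≡ᵇ x then 0 else suc (pos ys x)

-- the element of S appearing last in τ
pivotFrom : List ℕ → ℕ → List ℕ → ℕ
pivotFrom τ best [] = best
pivotFrom τ best (x ∷ xs) = pivotFrom τ (if pos τ best <ᵇ pos τ x then x else best) xs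

pivot : List ℕ → List ℕ → ℕ
pivot τ [] = 0
pivot τ (x ∷ xs) = pivotFrom τ x xs

-- distinct positive values A_{py}, y ∈ U, in decreasing order
maxList : List ℕ → ℕ
maxList = foldr _⊔_ 0

simValues : ℕ → ℕ → List ℕ → List ℕ
simValues n p U =
  filterᵇ (λ a → any (λ y → A n p y ≡ᵇ a) U)
          (map suc (downFrom (maxList (map (A n p) U))))

nonEmpty : List ℕ → Bool
nonEmpty [] = false
nonEmpty (_ ∷ _) = true

-- refine one class B by the similarity partition (C_1,...,C_s), then B \ ∪C_i
refineClass : ℕ → ℕ → List ℕ → List ℕ → List (List ℕ)
refineClass n p vals B =
  map (λ a → filterᵇ (λ y → A n p y ≡ᵇ a) B) vals
  ++ (filterᵇ (λ y → A n p y ≡ᵇ 0) B ∷ [])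

refine : ℕ → ℕ → List (List ℕ) → List (List ℕ)
refine n p φ = filterᵇ nonEmpty (concat (map (refineClass n p (simValues n p (concat φ))) φ))

sfsLoop : ℕ → List ℕ → ℕ → List (List ℕ) → List ℕ
sfsLoop n τ zero φ = []
sfsLoop n τ (suc k) [] = []
sfsLoop n τ (suc k) (S ∷ φ) =
  let p = pivot τ S
  in p ∷ sfsLoop n τ k (refine n p (filterᵇ (λ x → not (x ≡ᵇ p)) S ∷ φ))

vertices : ℕ → List ℕ
vertices n = map suc (upTo n)

SFS+ : ℕ → List ℕ → List ℕ
SFS+ n τ = sfsLoop n τ n (vertices n ∷ [])

σ : ℕ → ℕ → List ℕ
σ n zero = map (λ i → suc (suc i)) (upTo (n ∸ 1)) ++ (1 ∷ [])
σ n (suc i) = SFS+ n (σ n i)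

-- For n = 2m + u + 1 the order σ_{2m} is evenShape m u: the runs 2m+u+1 … m+u+2 (descending), m+2 … m+u+1 (ascending)
-- and m+1 … 1 (descending); for n = 2m + u + 2 the order σ_{2m+1} is oddShape m u: the runs 1 … m+1, m+u+1 … m+2
-- (descending) and m+u+2 … 2m+u+2. Each sweep of SFS+ is computed exactly, using that above the diagonal
-- A_ij = min(i - [i + j > n], n + 2 - j): the first pivots peel the outer runs off one at a time and the middle run is
-- reversed, so u drops by one per sweep. For u = 1 the two shapes are the identity and its reverse, which are Robinson
-- orderings of A because A_ij decreases in j and increases in i; for u ≥ 2 each shape contains a triple violating the
-- Robinson inequality.

module Submission where

open import Defs
open import Data.Nat
open import Data.Nat.Properties
open import Data.Nat.Tactic.RingSolver using (solve-∀)
open import Data.Bool using (true; false; not; T)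
open import Data.Bool.ListAction using (any)
open import Data.Empty using (⊥; ⊥-elim)
open import Data.Unit using (⊤; tt)
open import Data.Product using (_×_; _,_; proj₁; proj₂; Σ)
open import Data.Sum using (_⊎_; inj₁; inj₂)
open import Data.Fin as Fin using (Fin; toℕ; fromℕ<)
open import Data.Fin.Properties using (toℕ-fromℕ<; toℕ<n)
open import Data.List using (List; []; _∷_; _++_; concat; map; filterᵇ; downFrom; length; lookup; applyUpTo; [_])
open import Data.List.Properties
  using (++-assoc; ++-identityʳ; length-++; concat-map-[_]; map-++; concat-++; ∷-injective;
         filter-++; filter-all; filter-none; filter-accept; filter-reject; length-filter; map-cong-local)
open import Data.List.Relation.Unary.All as All using (All; []; _∷_)
open import Data.List.Relation.Unary.All.Properties using (++⁺; ++⁻ˡ; filter⁺; map⁺)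
open import Data.List.Relation.Unary.Any using (here; there)
open import Data.List.Relation.Unary.Any.Properties using (any⁺)
open import Data.List.Relation.Unary.AllPairs using (AllPairs; []; _∷_)
import Data.List.Relation.Unary.AllPairs.Properties as AllPairs
open import Data.List.Relation.Binary.Subset.Propositional using (_⊆_)
open import Data.List.Membership.Propositional using (_∈_; lose)
open import Data.List.Membership.Propositional.Properties using (∈-++⁺ˡ; ∈-++⁺ʳ; ∈-filter⁺; ∈-filter⁻; ∈-map⁺; ∈-downFrom⁺)
open import Relation.Binary.PropositionalEquality hiding ([_])
open ≡-Reasoning
open import Relation.Binary.Definitions using (tri<; tri≈; tri>)
open import Relation.Nullary using (¬_; yes; no)
open import Relation.Nullary.Decidable using (T?)
open import Function using (id; _∘_; _on_)

≡ᵇ-true : ∀ {m n} → m ≡ n → (m ≡ᵇ n) ≡ true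
≡ᵇ-true {m} {n} m≡n with m ≡ᵇ n | ≡⇒≡ᵇ m n m≡n
... | true | _ = refl

≡ᵇ-false : ∀ {m n} → m ≢ n → (m ≡ᵇ n) ≡ false
≡ᵇ-false {m} {n} m≢n with m ≡ᵇ n in eq
... | false = refl
... | true = ⊥-elim (m≢n (≡ᵇ⇒≡ m n (subst T (sym eq) tt)))

<ᵇ-true : ∀ {m n} → m < n → (m <ᵇ n) ≡ true
<ᵇ-true {m} {n} m<n with m <ᵇ n | <⇒<ᵇ m<n
... | true | _ = refl

<ᵇ-false : ∀ {m n} → n ≤ m → (m <ᵇ n) ≡ false
<ᵇ-false {m} {n} n≤m with m <ᵇ n in eq
... | false = refl
... | true = ⊥-elim (≤⇒≯ n≤m (<ᵇ⇒< m n (subst T (sym eq) tt)))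

Aup-step : ∀ n i j → j ≢ n → Aup n (suc (suc i)) j ≡ suc (Aup n (suc i) (suc j))
Aup-step n i j j≢n rewrite ≡ᵇ-false j≢n = refl

Aup-row₁ : ∀ n j → j ≢ n → Aup n 1 j ≡ 1
Aup-row₁ n j j≢n rewrite ≡ᵇ-false j≢n = refl

Aup-low : ∀ n i j → 1 ≤ i → i + j ≤ n → Aup n i j ≡ i
Aup-low n (suc zero) j _ h = Aup-row₁ n j (λ e → 1+n≰n (subst (λ z → suc z ≤ n) e h))
Aup-low n (suc (suc i)) j _ h =
  trans (Aup-step n i j (λ e → 1+n≰n (subst (λ z → suc z ≤ n) e (≤-trans (s≤s (m≤n+m j (suc i))) h))))
        (cong suc (Aup-low n (suc i) (suc j) (s≤s z≤n) (subst (_≤ n) (sym (+-suc (suc i) j)) h)))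

Aup-n+1 : ∀ n i j → suc i + j ≡ suc n → Aup n (suc i) j ≡ i
Aup-n+1 n zero j h rewrite ≡ᵇ-true {j} {n} (suc-injective h) = refl
Aup-n+1 n (suc i) j h =
  trans (Aup-step n i j (λ e → 1+n≰n (subst (λ z → suc z ≤ n) e (≤-trans (s≤s (m≤n+m j i)) (≤-reflexive (suc-injective h))))))
        (cong suc (Aup-n+1 n i (suc j) (trans (+-suc (suc i) j) h)))

Aup-n+2 : ∀ n i j → j ≤ n → suc i + j ≡ suc (suc n) → Aup n (suc i) j ≡ i
Aup-n+2 n zero j jn h = ⊥-elim (1+n≰n (subst (_≤ n) (suc-injective h) jn))
Aup-n+2 n (suc i) j jn h with j ≟ n
... | yes refl rewrite ≡ᵇ-true {j} {j} refl | +-cancelʳ-≡ j i 0 (suc-injective (suc-injective h)) = refl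
... | no ne = trans (Aup-step n i j ne) (cong suc (Aup-n+2 n i (suc j) (≤∧≢⇒< jn ne) (trans (+-suc (suc i) j) h)))

Aup-high : ∀ n i j v → j ≤ n → j + v ≡ suc (suc n) → suc (suc (suc n)) ≤ i + j → Aup n i j ≡ v
Aup-high n zero j v jn e h = ⊥-elim (1+n≰n (≤-trans (n≤1+n _) (≤-trans (n≤1+n _) (≤-trans h jn))))
Aup-high n (suc zero) j v jn e (s≤s h) = ⊥-elim (1+n≰n (≤-trans (n≤1+n _) (≤-trans h jn)))
Aup-high n (suc (suc i)) j v jn e h with j ≟ n
Aup-high n (suc (suc zero)) j v jn e h | yes refl = ⊥-elim (1+n≰n (≤-pred (≤-pred h)))
Aup-high n (suc (suc (suc i))) j v jn e h | yes refl rewrite ≡ᵇ-true {j} {j} refl = sym (+-cancelˡ-≡ j v 2 (trans e (+-comm 2 j)))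
Aup-high n (suc (suc i)) j zero jn e h | no ne = ⊥-elim (1+n≰n (≤-trans (n≤1+n _) (subst (_≤ n) (trans (sym (+-identityʳ j)) e) jn)))
Aup-high n (suc (suc i)) j (suc v) jn e h | no ne rewrite ≡ᵇ-false {j} {n} ne
  = cong suc (Aup-high n (suc i) (suc j) v (≤∧≢⇒< jn ne) (trans (sym (+-suc j v)) e) (subst (suc (suc (suc n)) ≤_) (sym (+-suc (suc i) j)) h))

data Zone (n i j : ℕ) : Set where
  low : i + j ≤ n → Zone n i j
  at-n+1 : i + j ≡ suc n → Zone n i j
  at-n+2 : i + j ≡ suc (suc n) → Zone n i j
  high : suc (suc (suc n)) ≤ i + j → Zone n i j

zone : ∀ n i j → Zone n i j
zone n i j with i + j ≤? n
... | yes p = low p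
... | no p with i + j ≟ suc n
...   | yes q = at-n+1 q
...   | no q with i + j ≟ suc (suc n)
...     | yes r = at-n+2 r
...     | no r = high (≤∧≢⇒< (≤∧≢⇒< (≰⇒> p) (λ e → q (sym e))) (λ e → r (sym e)))

-- row i of Aup is i up to the anti-diagonal i + j = n, one less on the next two diagonals, and n + 2 - j beyond
rowValue : ℕ → ℕ → ℕ → ℕ
rowValue n i j = (i ∸ ((i + j ∸ n) ⊓ 1)) ⊓ (2 + n ∸ j)

Aup-rowValue : ∀ n i j → 1 ≤ i → j ≤ n → Aup n i j ≡ rowValue n i j
Aup-rowValue n i j 1≤i j≤n with zone n i j
... | low i+j≤n rewrite Aup-low n i j 1≤i i+j≤n | m≤n⇒m∸n≡0 i+j≤n =
  sym (m≤n⇒m⊓n≡m (m+n≤o⇒m≤o∸n i (≤-trans i+j≤n (≤-trans (n≤1+n n) (n≤1+n _)))))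
Aup-rowValue n (suc i) j _ _ | at-n+1 i+j≡ rewrite Aup-n+1 n i j i+j≡ | i+j≡ | m+n∸n≡m 1 n
                                                 | sym (cong suc i+j≡) | m+n∸n≡m (2 + i) j =
  sym (m≤n⇒m⊓n≡m (≤-trans (n≤1+n i) (n≤1+n _)))
Aup-rowValue n (suc i) j _ j≤n | at-n+2 i+j≡ rewrite Aup-n+2 n i j j≤n i+j≡ | i+j≡ | m+n∸n≡m 2 n
                                                   | sym i+j≡ | m+n∸n≡m (suc i) j =
  sym (m≤n⇒m⊓n≡m (n≤1+n i))
Aup-rowValue n i j 1≤i j≤n | high n+3≤i+j
  rewrite Aup-high n i j (2 + n ∸ j) j≤n (m+[n∸m]≡n (≤-trans j≤n (≤-trans (n≤1+n n) (n≤1+n _)))) n+3≤i+j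
        | m≥n⇒m⊓n≡n {i + j ∸ n} {1} (m+n≤o⇒m≤o∸n 1 (≤-trans (n≤1+n _) (≤-trans (n≤1+n _) n+3≤i+j))) =
  sym (m≥n⇒m⊓n≡n (m≤n+o⇒m∸n≤o (2 + n) j (subst (2 + n ≤_) (trans (cong (_∸ 1) (+-comm i j)) (+-∸-assoc j 1≤i)) (∸-monoˡ-≤ 1 n+3≤i+j))))

rowValue-antitoneʳ : ∀ n i {j j′} → j ≤ j′ → rowValue n i j′ ≤ rowValue n i j
rowValue-antitoneʳ n i j≤j′ = ⊓-mono-≤ (∸-monoʳ-≤ i (⊓-monoˡ-≤ 1 (∸-monoˡ-≤ n (+-monoʳ-≤ i j≤j′)))) (∸-monoʳ-≤ (2 + n) j≤j′)

rowValue-monotoneˡ : ∀ n j {i i′} → i < i′ → rowValue n i j ≤ rowValue n i′ j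
rowValue-monotoneˡ n j {i} {i′} i<i′ =
  ⊓-monoˡ-≤ (2 + n ∸ j) (≤-trans (m∸n≤m i ((i + j ∸ n) ⊓ 1)) (≤-trans (<⇒≤pred i<i′) (∸-monoʳ-≤ i′ (m⊓n≤n (i′ + j ∸ n) 1))))

A-< : ∀ n x y → x < y → A n x y ≡ Aup n x y
A-< n x y x<y rewrite <ᵇ-true x<y = refl

A-> : ∀ n x y → y < x → A n x y ≡ Aup n y x
A-> n x y y<x rewrite <ᵇ-false (<⇒≤ y<x) | <ᵇ-true y<x = refl

A-sym : ∀ n x y → A n x y ≡ A n y x
A-sym n x y with <-cmp x y
... | tri< x<y _ _ = trans (A-< n x y x<y) (sym (A-> n y x x<y))
... | tri≈ _ refl _ = refl
... | tri> _ _ y<x = trans (A-> n x y y<x) (sym (A-< n y x y<x))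

A-robinson-triple : ∀ n x y z → 1 ≤ x → x < y → y < z → z ≤ n → A n x z ≤ A n x y ⊓ A n y z
A-robinson-triple n x y z 1≤x x<y y<z z≤N
  rewrite A-< n x z (<-trans x<y y<z) | A-< n x y x<y | A-< n y z y<z
        | Aup-rowValue n x z 1≤x z≤N | Aup-rowValue n x y 1≤x (≤-trans (<⇒≤ y<z) z≤N)
        | Aup-rowValue n y z (≤-trans 1≤x (<⇒≤ x<y)) z≤N =
  ⊓-glb (rowValue-antitoneʳ n x (<⇒≤ y<z)) (rowValue-monotoneˡ n z x<y)

classOf : (ℕ → ℕ) → ℕ → List ℕ → List ℕ
classOf f a = filterᵇ (λ y → f y ≡ᵇ a)

below : (ℕ → ℕ) → ℕ → List ℕ → List ℕ
below f c = filterᵇ (λ y → f y <ᵇ c)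

-- refineClass n p vals, with the row A n p abstracted to f
split : (ℕ → ℕ) → List ℕ → List ℕ → List (List ℕ)
split f vals B = filterᵇ nonEmpty (map (λ a → classOf f a B) vals ++ [ classOf f 0 B ])

record Spectrum (f : ℕ → ℕ) (vals U : List ℕ) : Set where
  field
    descending : AllPairs _>_ vals
    positive : All (0 <_) vals
    complete : ∀ {y} → y ∈ U → 0 < f y → f y ∈ vals

open Spectrum

Spectrum-⊆ : ∀ {f vals U V} → V ⊆ U → Spectrum f vals U → Spectrum f vals V
Spectrum-⊆ V⊆U s = record { descending = descending s ; positive = positive s ; complete = complete s ∘ V⊆U }

module _ (f : ℕ → ℕ) where

  classOf-all : ∀ {a B} → All (λ y → f y ≡ a) B → classOf f a B ≡ B
  classOf-all {a} = filter-all (λ y → T? (f y ≡ᵇ a)) ∘ All.map (≡⇒≡ᵇ _ a)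

  classOf-none : ∀ {a B} → All (λ y → f y ≢ a) B → classOf f a B ≡ []
  classOf-none {a} = filter-none (λ y → T? (f y ≡ᵇ a)) ∘ All.map (λ f≢a t → f≢a (≡ᵇ⇒≡ _ a t))

  below-all : ∀ {c B} → All (λ y → f y < c) B → below f c B ≡ B
  below-all {c} = filter-all (λ y → T? (f y <ᵇ c)) ∘ All.map <⇒<ᵇ

  below-none : ∀ {c B} → All (λ y → c ≤ f y) B → below f c B ≡ []
  below-none {c} = filter-none (λ y → T? (f y <ᵇ c)) ∘ All.map (λ c≤f t → ≤⇒≯ c≤f (<ᵇ⇒< _ c t))

  below-< : ∀ {c B y} → y ∈ below f c B → f y < c
  below-< {c} {B} y∈ = <ᵇ⇒< _ c (proj₂ (∈-filter⁻ (λ y → T? (f y <ᵇ c)) {xs = B} y∈))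

  below-⊆ : ∀ {c B y} → y ∈ below f c B → y ∈ B
  below-⊆ {c} {B} y∈ = proj₁ (∈-filter⁻ (λ y → T? (f y <ᵇ c)) {xs = B} y∈)

  classOf-∷-≡ : ∀ {a y B} → f y ≡ a → classOf f a (y ∷ B) ≡ y ∷ classOf f a B
  classOf-∷-≡ {a} = filter-accept (λ y → T? (f y ≡ᵇ a)) ∘ ≡⇒≡ᵇ _ a

  classOf-∷-≢ : ∀ {a y B} → f y ≢ a → classOf f a (y ∷ B) ≡ classOf f a B
  classOf-∷-≢ {a} fy≢a = filter-reject (λ y → T? (f y ≡ᵇ a)) (fy≢a ∘ ≡ᵇ⇒≡ _ a)

  below-∷-< : ∀ {c y B} → f y < c → below f c (y ∷ B) ≡ y ∷ below f c B
  below-∷-< {c} = filter-accept (λ y → T? (f y <ᵇ c)) ∘ <⇒<ᵇ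

  below-∷-≥ : ∀ {c y B} → c ≤ f y → below f c (y ∷ B) ≡ below f c B
  below-∷-≥ {c} c≤fy = filter-reject (λ y → T? (f y <ᵇ c)) (≤⇒≯ c≤fy ∘ <ᵇ⇒< _ c)

  classOf-below : ∀ {a c} B → a < c → classOf f a (below f c B) ≡ classOf f a B
  classOf-below [] _ = refl
  classOf-below {a} {c} (y ∷ B) a<c with f y <? c | f y ≟ a
  ... | yes fy<c | yes fy≡a
    rewrite below-∷-< {B = B} fy<c | classOf-∷-≡ {B = below f c B} fy≡a | classOf-∷-≡ {B = B} fy≡a
    = cong (y ∷_) (classOf-below B a<c)
  ... | yes fy<c | no fy≢a
    rewrite below-∷-< {B = B} fy<c | classOf-∷-≢ {B = below f c B} fy≢a | classOf-∷-≢ {B = B} fy≢a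
    = classOf-below B a<c
  ... | no fy≮c | yes refl = ⊥-elim (fy≮c a<c)
  ... | no fy≮c | no fy≢a
    rewrite below-∷-≥ {B = B} (≮⇒≥ fy≮c) | classOf-∷-≢ {B = B} fy≢a = classOf-below B a<c

  split-[] : ∀ vals → split f vals [] ≡ []
  split-[] [] = refl
  split-[] (v ∷ vs) = split-[] vs

  split-skip : ∀ {v vs B} → All (λ y → f y ≢ v) B → split f (v ∷ vs) B ≡ split f vs B
  split-skip {v} {vs} {B} h rewrite classOf-none {v} {B} h = refl

  split-head : ∀ {v vs B x} → x ∈ B → f x ≡ v → split f (v ∷ vs) B ≡ classOf f v B ∷ split f vs B
  split-head {v} {vs} {B} x∈B fx≡v
    with classOf f v B | ∈-filter⁺ (λ y → T? (f y ≡ᵇ v)) {xs = B} x∈B (≡⇒≡ᵇ _ v fx≡v)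
  ... | _ ∷ _ | _ = refl

  split-below : ∀ {vs c} B → All (_< c) vs → 0 < c → split f vs (below f c B) ≡ split f vs B
  split-below B vs<c 0<c =
    cong (filterᵇ nonEmpty) (cong₂ _++_ (map-cong-local (All.map (classOf-below B) vs<c))
                                        (cong [_] (classOf-below B 0<c)))


  split-peel : ∀ {vals B x c} → x ∈ B → f x ≡ c → 0 < c → All (λ y → f y ≤ c) B → Spectrum f vals B →
    split f vals B ≡ classOf f c B ∷ split f vals (below f c B)
  split-peel {vals} {B} {x} {c} x∈B fx≡c 0<c B≤c s =
    go vals (subst (_∈ vals) fx≡c (complete s x∈B (subst (0 <_) (sym fx≡c) 0<c))) (descending s)
    where
    below≢ : ∀ {v} → c ≤ v → All (λ y → f y ≢ v) (below f c B)
    below≢ c≤v = All.tabulate λ y∈ e → <-irrefl e (<-≤-trans (below-< {B = B} y∈) c≤v)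
    go : ∀ vs → c ∈ vs → AllPairs _>_ vs → split f vs B ≡ classOf f c B ∷ split f vs (below f c B)
    go (v ∷ vs) c∈ (vs<v ∷ vs↓) with <-cmp c v
    ... | tri≈ _ refl _ =
      trans (split-head x∈B fx≡c)
            (cong (classOf f c B ∷_) (sym (trans (split-skip (below≢ ≤-refl)) (split-below B vs<v 0<c))))
    ... | tri< c<v _ _ with c∈
    ...   | here c≡v = ⊥-elim (<-irrefl c≡v c<v)
    ...   | there c∈vs =
      trans (split-skip (All.map (λ fy≤c e → <-irrefl e (≤-<-trans fy≤c c<v)) B≤c))
            (trans (go vs c∈vs vs↓) (cong (classOf f c B ∷_) (sym (split-skip (below≢ (<⇒≤ c<v))))))
    go (v ∷ vs) (here c≡v) _ | tri> _ c≢v _ = ⊥-elim (c≢v c≡v)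
    go (v ∷ vs) (there c∈vs) (vs<v ∷ _) | tri> _ _ v<c = ⊥-elim (<-asym v<c (All.lookup vs<v c∈vs))

  split-zeros : ∀ {vals B x} → x ∈ B → All (λ y → f y ≡ 0) B → All (0 <_) vals → split f vals B ≡ [ B ]
  split-zeros {[]} {B} x∈B zeros [] rewrite classOf-all zeros with B | x∈B
  ... | _ ∷ _ | _ = refl
  split-zeros {v ∷ vs} x∈B zeros (0<v ∷ pos) =
    trans (split-skip (All.map (λ f≡0 f≡v → <-irrefl (trans (sym f≡0) f≡v) 0<v) zeros)) (split-zeros x∈B zeros pos)

  split-constant : ∀ {vals B x c} → x ∈ B → All (λ y → f y ≡ c) B → Spectrum f vals B → split f vals B ≡ [ B ]
  split-constant {c = zero} x∈B const s = split-zeros x∈B const (positive s)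
  split-constant {vals} {B} {c = suc c} x∈B const s =
    trans (split-peel x∈B (All.lookup const x∈B) z<s (All.map ≤-reflexive const) s)
          (cong₂ _∷_ (classOf-all const)
                     (trans (cong (split f vals) (below-none (All.map (≤-reflexive ∘ sym) const))) (split-[] vals)))

  classOf-++ : ∀ {a} xs ys → classOf f a (xs ++ ys) ≡ classOf f a xs ++ classOf f a ys
  classOf-++ {a} = filter-++ (λ y → T? (f y ≡ᵇ a))

  below-++ : ∀ {c} xs ys → below f c (xs ++ ys) ≡ below f c xs ++ below f c ys
  below-++ {c} = filter-++ (λ y → T? (f y <ᵇ c))

  classOf++below : ∀ {c B} → AllPairs (_≥_ on f) B → All (λ y → f y ≤ c) B → classOf f c B ++ below f c B ≡ B
  classOf++below [] [] = refl
  classOf++below {c} {y ∷ B} (B≤y ∷ B↓) (fy≤c ∷ B≤c) with m≤n⇒m<n∨m≡n fy≤c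
  ... | inj₂ fy≡c rewrite classOf-∷-≡ {B = B} fy≡c | below-∷-≥ {B = B} (≤-reflexive (sym fy≡c)) =
    cong (y ∷_) (classOf++below B↓ B≤c)
  ... | inj₁ fy<c = trans (cong₂ _++_ (classOf-none (All.map (λ f<c f≡c → <-irrefl f≡c f<c) B<c)) (below-all B<c)) refl
    where
    B<c : All (λ z → f z < c) (y ∷ B)
    B<c = fy<c ∷ All.map (λ fz≤fy → ≤-<-trans fz≤fy fy<c) B≤y

  split-antitone : ∀ {vals B} → AllPairs (_≥_ on f) B → Spectrum f vals B →
    concat (split f vals B) ≡ B × All (T ∘ nonEmpty) (split f vals B)
  split-antitone {vals} {B} = go (length B) ≤-refl
    where
    go : ∀ k {B} → length B ≤ k → AllPairs (_≥_ on f) B → Spectrum f vals B →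
      concat (split f vals B) ≡ B × All (T ∘ nonEmpty) (split f vals B)
    go _ {[]} _ _ _ rewrite split-[] vals = refl , []
    go (suc k) {x ∷ xs} (s≤s len) B↓@(xs≤x ∷ xs↓) s = peel (f x) refl
      where
      B≤ : ∀ {c} → f x ≡ c → All (λ y → f y ≤ c) (x ∷ xs)
      B≤ refl = ≤-refl ∷ xs≤x
      peel : ∀ c → f x ≡ c → concat (split f vals (x ∷ xs)) ≡ x ∷ xs × All (T ∘ nonEmpty) (split f vals (x ∷ xs))
      peel zero fx≡0 rewrite split-zeros (here refl) (All.map n≤0⇒n≡0 (B≤ fx≡0)) (positive s) =
        ++-identityʳ (x ∷ xs) , tt ∷ []
      peel (suc c) fx≡c
        with ih ← go k (subst (λ C → length C ≤ k) (sym (below-∷-≥ {B = xs} (≤-reflexive (sym fx≡c))))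
                           (≤-trans (length-filter (λ y → T? (f y <ᵇ suc c)) xs) len))
                       (AllPairs.filter⁺ (λ y → T? (f y <ᵇ suc c)) B↓) (Spectrum-⊆ (below-⊆ {suc c}) s)
        rewrite split-peel (here refl) fx≡c z<s (B≤ fx≡c) s =
        trans (cong (classOf f (suc c) (x ∷ xs) ++_) (proj₁ ih)) (classOf++below B↓ (B≤ fx≡c)) ,
        subst (T ∘ nonEmpty) (sym (classOf-∷-≡ {B = xs} fx≡c)) tt ∷ proj₂ ih

  split-max-block : ∀ {vals L M R c x} → x ∈ M → 0 < c →
    All (λ y → f y < c) L → All (λ y → f y ≡ c) M → All (λ y → f y < c) R →
    Spectrum f vals (L ++ M ++ R) → split f vals (L ++ M ++ R) ≡ M ∷ split f vals (L ++ R)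
  split-max-block {vals} {L} {M} {R} {c} x∈M 0<c L<c M≡c R<c s =
    trans (split-peel (∈-++⁺ʳ L (∈-++⁺ˡ x∈M)) (All.lookup M≡c x∈M) 0<c
                      (++⁺ (All.map <⇒≤ L<c) (++⁺ (All.map ≤-reflexive M≡c) (All.map <⇒≤ R<c))) s)
          (cong₂ _∷_ classOf≡M (cong (split f vals) below≡L++R))
    where
    ≢c : ∀ {xs} → All (λ y → f y < c) xs → All (λ y → f y ≢ c) xs
    ≢c = All.map λ f<c f≡c → <-irrefl f≡c f<c
    classOf≡M : classOf f c (L ++ M ++ R) ≡ M
    classOf≡M = begin
      classOf f c (L ++ M ++ R)                          ≡⟨ classOf-++ {c} L (M ++ R) ⟩
      classOf f c L ++ classOf f c (M ++ R)              ≡⟨ cong₂ _++_ (classOf-none (≢c L<c)) (classOf-++ {c} M R) ⟩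
      classOf f c M ++ classOf f c R                     ≡⟨ cong₂ _++_ (classOf-all M≡c) (classOf-none (≢c R<c)) ⟩
      M ++ []                                            ≡⟨ ++-identityʳ M ⟩
      M                                                  ∎
    below≡L++R : below f c (L ++ M ++ R) ≡ L ++ R
    below≡L++R = begin
      below f c (L ++ M ++ R)                            ≡⟨ below-++ {c} L (M ++ R) ⟩
      below f c L ++ below f c (M ++ R)                  ≡⟨ cong₂ _++_ (below-all L<c) (below-++ {c} M R) ⟩
      L ++ below f c M ++ below f c R                    ≡⟨ cong (λ Z → L ++ Z ++ below f c R) (below-none (All.map (≤-reflexive ∘ sym) M≡c)) ⟩
      L ++ below f c R                                   ≡⟨ cong (L ++_) (below-all R<c) ⟩
      L ++ R                                             ∎

  split-two-descending : ∀ {vals B₁ B₂ c₁ c₂ x₁ x₂} → x₁ ∈ B₁ → x₂ ∈ B₂ →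
    All (λ y → f y ≡ c₁) B₁ → All (λ y → f y ≡ c₂) B₂ → c₂ < c₁ →
    Spectrum f vals (B₁ ++ B₂) → split f vals (B₁ ++ B₂) ≡ B₁ ∷ B₂ ∷ []
  split-two-descending {vals} {B₁} {B₂} x₁∈ x₂∈ B₁≡ B₂≡ c₂<c₁ s =
    trans (split-max-block {L = []} x₁∈ (≤-<-trans z≤n c₂<c₁) [] B₁≡ (All.map (λ e → subst (_< _) (sym e) c₂<c₁) B₂≡) s)
          (cong (B₁ ∷_) (split-constant x₂∈ B₂≡ (Spectrum-⊆ (∈-++⁺ʳ B₁) s)))

  split-two-ascending : ∀ {vals B₁ B₂ c₁ c₂ x₁ x₂} → x₁ ∈ B₁ → x₂ ∈ B₂ →
    All (λ y → f y ≡ c₁) B₁ → All (λ y → f y ≡ c₂) B₂ → c₁ < c₂ →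
    Spectrum f vals (B₁ ++ B₂) → split f vals (B₁ ++ B₂) ≡ B₂ ∷ B₁ ∷ []
  split-two-ascending {vals} {B₁} {B₂} x₁∈ x₂∈ B₁≡ B₂≡ c₁<c₂ s = begin
    split f vals (B₁ ++ B₂)             ≡⟨ cong (λ B → split f vals (B₁ ++ B)) (sym (++-identityʳ B₂)) ⟩
    split f vals (B₁ ++ B₂ ++ [])       ≡⟨ split-max-block x₂∈ (≤-<-trans z≤n c₁<c₂) B₁<c₂ B₂≡ [] s′ ⟩
    B₂ ∷ split f vals (B₁ ++ [])        ≡⟨ cong (B₂ ∷_) (split-constant (∈-++⁺ˡ x₁∈) (++⁺ B₁≡ []) (Spectrum-⊆ ∈-B₁ s)) ⟩
    B₂ ∷ (B₁ ++ []) ∷ []                ≡⟨ cong (λ B → B₂ ∷ B ∷ []) (++-identityʳ B₁) ⟩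
    B₂ ∷ B₁ ∷ []                        ∎
    where
    B₁<c₂ = All.map (λ e → subst (_< _) (sym e) c₁<c₂) B₁≡
    s′ = subst (Spectrum f vals) (cong (B₁ ++_) (sym (++-identityʳ B₂))) s
    ∈-B₁ : B₁ ++ [] ⊆ B₁ ++ B₂
    ∈-B₁ = ∈-++⁺ˡ ∘ subst (_ ∈_) (++-identityʳ B₁)

  split-three-ascending : ∀ {vals B₁ B₂ B₃ c₁ c₂ c₃ x₁ x₂ x₃} → x₁ ∈ B₁ → x₂ ∈ B₂ → x₃ ∈ B₃ →
    All (λ y → f y ≡ c₁) B₁ → All (λ y → f y ≡ c₂) B₂ → All (λ y → f y ≡ c₃) B₃ → c₁ < c₂ → c₂ < c₃ →
    Spectrum f vals (B₁ ++ B₂ ++ B₃) → split f vals (B₁ ++ B₂ ++ B₃) ≡ B₃ ∷ B₂ ∷ B₁ ∷ []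
  split-three-ascending {vals} {B₁} {B₂} {B₃} x₁∈ x₂∈ x₃∈ B₁≡ B₂≡ B₃≡ c₁<c₂ c₂<c₃ s = begin
    split f vals (B₁ ++ B₂ ++ B₃)            ≡⟨ cong (split f vals) reassoc ⟩
    split f vals ((B₁ ++ B₂) ++ B₃ ++ [])    ≡⟨ split-max-block x₃∈ (≤-<-trans z≤n c₂<c₃) B₁₂<c₃ B₃≡ [] (subst (Spectrum f vals) reassoc s) ⟩
    B₃ ∷ split f vals ((B₁ ++ B₂) ++ [])     ≡⟨ cong (λ B → B₃ ∷ split f vals B) (++-identityʳ (B₁ ++ B₂)) ⟩
    B₃ ∷ split f vals (B₁ ++ B₂)             ≡⟨ cong (B₃ ∷_) (split-two-ascending x₁∈ x₂∈ B₁≡ B₂≡ c₁<c₂ (Spectrum-⊆ ∈-B₁₂ s)) ⟩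
    B₃ ∷ B₂ ∷ B₁ ∷ []                        ∎
    where
    reassoc : B₁ ++ B₂ ++ B₃ ≡ (B₁ ++ B₂) ++ B₃ ++ []
    reassoc = trans (sym (++-assoc B₁ B₂ B₃)) (cong ((B₁ ++ B₂) ++_) (sym (++-identityʳ B₃)))
    B₁₂<c₃ = ++⁺ (All.map (λ e → subst (_< _) (sym e) (<-trans c₁<c₂ c₂<c₃)) B₁≡) (All.map (λ e → subst (_< _) (sym e) c₂<c₃) B₂≡)
    ∈-B₁₂ : B₁ ++ B₂ ⊆ B₁ ++ B₂ ++ B₃
    ∈-B₁₂ y∈ = subst (_ ∈_) (++-assoc B₁ B₂ B₃) (∈-++⁺ˡ y∈)

≤-maxList : ∀ (f : ℕ → ℕ) {U y} → y ∈ U → f y ≤ maxList (map f U)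
≤-maxList f {x ∷ U} (here refl) = m≤m⊔n (f x) _
≤-maxList f {x ∷ U} (there y∈) = ≤-trans (≤-maxList f y∈) (m≤n⊔m (f x) _)

simValues-spectrum : ∀ n p U → Spectrum (A n p) (simValues n p U) U
simValues-spectrum n p U = record
  { descending = AllPairs.filter⁺ listed? (AllPairs.map⁺ (AllPairs.applyDownFrom⁺₁ id M (λ j<i _ → s≤s j<i)))
  ; positive = filter⁺ listed? (map⁺ (All.universal (λ _ → z<s) (downFrom M)))
  ; complete = listed
  }
  where
  M = maxList (map (A n p) U)
  listed? = λ a → T? (any (λ y → A n p y ≡ᵇ a) U)
  ∈-sucDownFrom : ∀ {a} → 0 < a → a ≤ M → a ∈ map suc (downFrom M)
  ∈-sucDownFrom {suc a} _ a<M = ∈-map⁺ suc (∈-downFrom⁺ a<M)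
  listed : ∀ {y} → y ∈ U → 0 < A n p y → A n p y ∈ simValues n p U
  listed {y} y∈ 0<a = ∈-filter⁺ listed? (∈-sucDownFrom 0<a (≤-maxList (A n p) y∈))
                                (any⁺ (λ y′ → A n p y′ ≡ᵇ A n p y) (lose y∈ (≡⇒≡ᵇ (A n p y) _ refl)))

refine-≡-split : ∀ n p φ → refine n p φ ≡ concat (map (split (A n p) (simValues n p (concat φ))) φ)
refine-≡-split n p φ = go φ
  where
  go : ∀ ψ → filterᵇ nonEmpty (concat (map (refineClass n p (simValues n p (concat φ))) ψ))
             ≡ concat (map (split (A n p) (simValues n p (concat φ))) ψ)
  vals = simValues n p (concat φ)
  go [] = refl
  go (B ∷ ψ) = trans (filter-++ (T? ∘ nonEmpty) (refineClass n p vals B) (concat (map (refineClass n p vals) ψ)))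
                     (cong (split (A n p) vals B ++_) (go ψ))

module _ (τ : List ℕ) where

  τ-last : ℕ → List ℕ → Set
  τ-last x S = x ∈ S × All (λ y → y ≡ x ⊎ pos τ y < pos τ x) S

  pivotFrom-τ-last : ∀ {best ys x} → τ-last x (best ∷ ys) → pivotFrom τ best ys ≡ x
  pivotFrom-τ-last {best} {[]} (here refl , _) = refl
  pivotFrom-τ-last {best} {y ∷ ys} {x} (x∈ , best≤ ∷ y≤ ∷ ys≤) with pos τ best <ᵇ pos τ y in eq
  ... | true = pivotFrom-τ-last (x∈y∷ys x∈ y≤ , y≤ ∷ ys≤)
    where
    best<y = <ᵇ⇒< (pos τ best) (pos τ y) (subst T (sym eq) tt)
    x∈y∷ys : x ∈ best ∷ y ∷ ys → y ≡ x ⊎ pos τ y < pos τ x → x ∈ y ∷ ys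
    x∈y∷ys (there x∈) _ = x∈
    x∈y∷ys (here refl) (inj₁ y≡x) = here (sym y≡x)
    x∈y∷ys (here refl) (inj₂ y<x) = ⊥-elim (<-asym y<x best<y)
  ... | false = pivotFrom-τ-last (x∈best∷ys x∈ best≤ , best≤ ∷ ys≤)
    where
    y≤best : pos τ y ≤ pos τ best
    y≤best = ≮⇒≥ (λ lt → subst T eq (<⇒<ᵇ lt))
    x∈best∷ys : x ∈ best ∷ y ∷ ys → best ≡ x ⊎ pos τ best < pos τ x → x ∈ best ∷ ys
    x∈best∷ys (here refl) _ = here refl
    x∈best∷ys (there (there x∈)) _ = there x∈
    x∈best∷ys (there (here refl)) (inj₁ best≡x) = here (sym best≡x)
    x∈best∷ys (there (here refl)) (inj₂ best<x) = ⊥-elim (<-irrefl refl (≤-<-trans y≤best best<x))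

  pivot-τ-last : ∀ {S x} → τ-last x S → pivot τ S ≡ x
  pivot-τ-last {_ ∷ _} = pivotFrom-τ-last

remove : ℕ → List ℕ → List ℕ
remove p = filterᵇ (λ x → not (x ≡ᵇ p))

remove-∉ : ∀ {p xs} → All (_≢ p) xs → remove p xs ≡ xs
remove-∉ {p} = filter-all (λ x → T? (not (x ≡ᵇ p))) ∘ All.map (λ x≢p → subst (T ∘ not) (sym (≡ᵇ-false x≢p)) tt)

remove-head : ∀ {p xs} → All (_≢ p) xs → remove p (p ∷ xs) ≡ xs
remove-head {p} xs≢p rewrite ≡ᵇ-true {p} refl = remove-∉ xs≢p

remove-last : ∀ {p} xs → All (_≢ p) xs → remove p (xs ++ [ p ]) ≡ xs
remove-last {p} xs xs≢p = begin
  remove p (xs ++ [ p ])         ≡⟨ filter-++ (λ x → T? (not (x ≡ᵇ p))) xs [ p ] ⟩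
  remove p xs ++ remove p [ p ]  ≡⟨ cong₂ _++_ (remove-∉ xs≢p) (remove-head {p} []) ⟩
  xs ++ []                       ≡⟨ ++-identityʳ xs ⟩
  xs                             ∎

split-singletons : ∀ {f vals} ys → Spectrum f vals ys → concat (map (split f vals) (map [_] ys)) ≡ map [_] ys
split-singletons [] s = refl
split-singletons (y ∷ ys) s =
  cong₂ _++_ (split-constant _ (here refl) (refl ∷ []) (Spectrum-⊆ (λ { (here refl) → here refl }) s))
             (split-singletons ys (Spectrum-⊆ there s))

refine-singletons : ∀ n p φ ys →
  refine n p (φ ++ map [_] ys) ≡ concat (map (split (A n p) (simValues n p (concat φ ++ ys))) φ) ++ map [_] ys
refine-singletons n p φ ys = begin
  refine n p (φ ++ map [_] ys)                              ≡⟨ refine-≡-split n p (φ ++ map [_] ys) ⟩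
  concat (map (split f (vals U′)) (φ ++ map [_] ys))        ≡⟨ cong (λ U → concat (map (split f (vals U)) (φ ++ map [_] ys))) U′≡U ⟩
  concat (map (split f (vals U)) (φ ++ map [_] ys))         ≡⟨ cong concat (map-++ (split f (vals U)) φ (map [_] ys)) ⟩
  concat (map (split f (vals U)) φ ++ map (split f (vals U)) (map [_] ys))
                                                            ≡⟨ sym (concat-++ (map (split f (vals U)) φ) _) ⟩
  concat (map (split f (vals U)) φ) ++ concat (map (split f (vals U)) (map [_] ys))
                                                            ≡⟨ cong (concat (map (split f (vals U)) φ) ++_) singletons ⟩
  concat (map (split f (vals U)) φ) ++ map [_] ys           ∎
  where
  f = A n p
  vals = simValues n p
  U = concat φ ++ ys
  U′ = concat (φ ++ map [_] ys)
  U′≡U : U′ ≡ U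
  U′≡U = trans (sym (concat-++ φ (map [_] ys))) (cong (concat φ ++_) (concat-map-[ ys ]))
  singletons = split-singletons ys (Spectrum-⊆ (∈-++⁺ʳ (concat φ)) (simValues-spectrum n p U))

refine-class∷singletons : ∀ n p C ys →
  refine n p (C ∷ map [_] ys) ≡ split (A n p) (simValues n p (C ++ ys)) C ++ map [_] ys
refine-class∷singletons n p C ys =
  trans (refine-singletons n p [ C ] ys)
        (trans (cong (_++ map [_] ys) (++-identityʳ _))
               (cong (λ U → split (A n p) (simValues n p (U ++ ys)) C ++ map [_] ys) (++-identityʳ C)))

sfsLoop-singletons : ∀ n τ K ys → length ys ≤ K → sfsLoop n τ K (map [_] ys) ≡ ys
sfsLoop-singletons n τ zero [] _ = refl
sfsLoop-singletons n τ (suc K) [] _ = refl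
sfsLoop-singletons n τ (suc K) (y ∷ ys) (s≤s len) rewrite ≡ᵇ-true {y} refl =
  cong (y ∷_) (trans (cong (sfsLoop n τ K) (trans (refine-class∷singletons n y [] ys)
                                                  (cong (_++ map [_] ys) (split-[] (A n y) (simValues n y ys)))))
                     (sfsLoop-singletons n τ K ys len))

sfsLoop-step : ∀ n τ K C ys x → τ-last τ x C →
  sfsLoop n τ (suc K) (C ∷ map [_] ys)
  ≡ x ∷ sfsLoop n τ K (split (A n x) (simValues n x (remove x C ++ ys)) (remove x C) ++ map [_] ys)
sfsLoop-step n τ K C ys x last rewrite pivot-τ-last τ last =
  cong (λ φ → x ∷ sfsLoop n τ K φ) (refine-class∷singletons n x (remove x C) ys)

AllPairs-++⁻ : ∀ {R : ℕ → ℕ → Set} xs {ys} → AllPairs R (xs ++ ys) → AllPairs R xs × AllPairs R ys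
AllPairs-++⁻ [] h = [] , h
AllPairs-++⁻ (x ∷ xs) (hx ∷ h) = (++⁻ˡ xs hx ∷ proj₁ (AllPairs-++⁻ xs h)) , proj₂ (AllPairs-++⁻ xs h)

splits-antitone : ∀ {f vals} φ → AllPairs (_≥_ on f) (concat φ) → Spectrum f vals (concat φ) →
  concat (concat (map (split f vals) φ)) ≡ concat φ × All (T ∘ nonEmpty) (concat (map (split f vals) φ))
splits-antitone [] _ _ = refl , []
splits-antitone {f} {vals} (C ∷ φ) ↓ s =
  trans (sym (concat-++ (split f vals C) _)) (cong₂ _++_ (proj₁ C-split) (proj₁ φ-split)) ,
  ++⁺ (proj₂ C-split) (proj₂ φ-split)
  where
  C-split = split-antitone f (proj₁ (AllPairs-++⁻ C ↓)) (Spectrum-⊆ ∈-++⁺ˡ s)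
  φ-split = splits-antitone φ (proj₂ (AllPairs-++⁻ C ↓)) (Spectrum-⊆ (∈-++⁺ʳ C) s)

-- a class listed in this order is output unchanged by SFS+: each element is the next pivot, and refining by it keeps the order
Sweepable : ℕ → List ℕ → List ℕ → Set
Sweepable n τ [] = ⊤
Sweepable n τ (x ∷ R) = All (λ y → pos τ y < pos τ x) R × AllPairs (_≥_ on A n x) R × Sweepable n τ R

sfsLoop-sweep : ∀ n τ {L} φ ys K → concat φ ≡ L → All (T ∘ nonEmpty) φ → Sweepable n τ L →
  length L + length ys ≤ K → sfsLoop n τ K (φ ++ map [_] ys) ≡ L ++ ys
sfsLoop-sweep n τ {[]} [] ys K _ _ _ len = sfsLoop-singletons n τ K ys len
sfsLoop-sweep n τ ([] ∷ φ) ys K _ (() ∷ _) _ _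
sfsLoop-sweep n τ {x ∷ R} ((x′ ∷ C) ∷ φ) ys (suc K) eq (_ ∷ φ≠[]) (R<x , R↓ , R-sweep) (s≤s len)
  with refl , C++φ≡R ← ∷-injective eq = begin
  sfsLoop n τ (suc K) (((x ∷ C) ∷ φ) ++ map [_] ys)
    ≡⟨ cong (λ p → p ∷ sfsLoop n τ K (refine n p (remove p (x ∷ C) ∷ φ ++ map [_] ys))) (pivot-τ-last τ last) ⟩
  x ∷ sfsLoop n τ K (refine n x (remove x (x ∷ C) ∷ φ ++ map [_] ys))
    ≡⟨ cong (λ B → x ∷ sfsLoop n τ K (refine n x (B ∷ φ ++ map [_] ys))) (remove-head (All.map (λ y<x y≡x → <-irrefl (cong (pos τ) y≡x) y<x) C<x)) ⟩
  x ∷ sfsLoop n τ K (refine n x ((C ∷ φ) ++ map [_] ys))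
    ≡⟨ cong (λ ψ → x ∷ sfsLoop n τ K ψ) (refine-singletons n x (C ∷ φ) ys) ⟩
  x ∷ sfsLoop n τ K (classes ++ map [_] ys)
    ≡⟨ cong (x ∷_) (sfsLoop-sweep n τ classes ys K (trans (proj₁ swept) C++φ≡R) (proj₂ swept) R-sweep len) ⟩
  x ∷ R ++ ys ∎
  where
  C<x : All (λ y → pos τ y < pos τ x) C
  C<x = ++⁻ˡ C (subst (All (λ y → pos τ y < pos τ x)) (sym C++φ≡R) R<x)
  last : τ-last τ x (x ∷ C)
  last = here refl , inj₁ refl ∷ All.map inj₂ C<x
  classes = concat (map (split (A n x) (simValues n x ((C ++ concat φ) ++ ys))) (C ∷ φ))
  swept = splits-antitone (C ∷ φ) (subst (AllPairs _) (sym C++φ≡R) R↓)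
                          (Spectrum-⊆ ∈-++⁺ˡ (simValues-spectrum n x ((C ++ concat φ) ++ ys)))

asc : ℕ → ℕ → List ℕ
asc a zero = []
asc a (suc k) = a ∷ asc (suc a) k

dsc : ℕ → ℕ → List ℕ
dsc a zero = []
dsc a (suc k) = (a + k) ∷ dsc a k

length-asc : ∀ a k → length (asc a k) ≡ k
length-asc a zero = refl
length-asc a (suc k) = cong suc (length-asc (suc a) k)

length-dsc : ∀ a k → length (dsc a k) ≡ k
length-dsc a zero = refl
length-dsc a (suc k) = cong suc (length-dsc a k)

InRange : ℕ → ℕ → ℕ → Set
InRange a k y = a ≤ y × y < a + k

asc-inRange : ∀ a k → All (InRange a k) (asc a k)
asc-inRange a zero = []
asc-inRange a (suc k) = (≤-refl , subst (a <_) (sym (+-suc a k)) (s≤s (m≤m+n a k)))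
  ∷ All.map (λ {y} (l , r) → ≤-trans (n≤1+n a) l , subst (y <_) (sym (+-suc a k)) r) (asc-inRange (suc a) k)

dsc-inRange : ∀ a k → All (InRange a k) (dsc a k)
dsc-inRange a zero = []
dsc-inRange a (suc k) = (m≤m+n a k , subst (a + k <_) (sym (+-suc a k)) ≤-refl)
  ∷ All.map (λ {y} (l , r) → l , ≤-trans r (subst (a + k ≤_) (sym (+-suc a k)) (n≤1+n _))) (dsc-inRange a k)

asc-++ : ∀ a k j → asc a (k + j) ≡ asc a k ++ asc (a + k) j
asc-++ a zero j rewrite +-identityʳ a = refl
asc-++ a (suc k) j rewrite asc-++ (suc a) k j | +-suc a k = refl

dsc-++ : ∀ a k j → dsc a (j + k) ≡ dsc (a + k) j ++ dsc a k
dsc-++ a k zero = refl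
dsc-++ a k (suc j) rewrite dsc-++ a k j | +-assoc a k j | +-comm k j = refl

∈-asc : ∀ a k {y} → InRange a k y → y ∈ asc a k
∈-asc a zero (l , r) = ⊥-elim (<-irrefl refl (≤-trans r (≤-trans (≤-reflexive (+-identityʳ a)) l)))
∈-asc a (suc k) {y} (l , r) with a ≟ y
... | yes refl = here refl
... | no ne = there (∈-asc (suc a) k (≤∧≢⇒< l ne , subst (y <_) (+-suc a k) r))

∈-dsc : ∀ a k {y} → InRange a k y → y ∈ dsc a k
∈-dsc a zero (l , r) = ⊥-elim (<-irrefl refl (≤-trans r (≤-trans (≤-reflexive (+-identityʳ a)) l)))
∈-dsc a (suc k) {y} (l , r) with y ≟ a + k
... | yes refl = here refl
... | no ne = there (∈-dsc a k (l , ≤∧≢⇒< (≤-pred (subst (y <_) (+-suc a k) r)) ne))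

∌-outside : ∀ {a k y} xs → All (InRange a k) xs → y < a ⊎ a + k ≤ y → All (_≢ y) xs
∌-outside xs inRange (inj₁ y<a) = All.map (λ (a≤z , _) z≡y → <-irrefl (sym z≡y) (<-≤-trans y<a a≤z)) inRange
∌-outside xs inRange (inj₂ a+k≤y) = All.map (λ (_ , z<a+k) z≡y → <-irrefl z≡y (<-≤-trans z<a+k a+k≤y)) inRange

asc-snoc : ∀ a k → asc a (suc k) ≡ asc a k ++ [ a + k ]
asc-snoc a zero rewrite +-identityʳ a = refl
asc-snoc a (suc k) rewrite asc-snoc (suc a) k | +-suc a k = refl

dsc-snoc : ∀ c w → dsc c (suc w) ≡ dsc (suc c) w ++ [ c ]
dsc-snoc c zero = cong [_] (+-identityʳ c)
dsc-snoc c (suc w) = cong₂ _∷_ (+-suc c w) (dsc-snoc c w)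

asc-∌-below : ∀ {x} a k → x < a → All (_≢ x) (asc a k)
asc-∌-below a k x<a = ∌-outside (asc a k) (asc-inRange a k) (inj₁ x<a)

asc-∌-above : ∀ {x} a k → a + k ≤ x → All (_≢ x) (asc a k)
asc-∌-above a k a+k≤x = ∌-outside (asc a k) (asc-inRange a k) (inj₂ a+k≤x)

map-applyUpTo-asc : ∀ (g f : ℕ → ℕ) a n → (∀ i → g (f i) ≡ a + i) → map g (applyUpTo f n) ≡ asc a n
map-applyUpTo-asc g f a zero h = refl
map-applyUpTo-asc g f a (suc n) h =
  cong₂ _∷_ (trans (h 0) (+-identityʳ a)) (map-applyUpTo-asc g (f ∘ suc) (suc a) n (λ i → trans (h (suc i)) (+-suc a i)))

vertices-asc : ∀ n → vertices n ≡ asc 1 n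
vertices-asc n = map-applyUpTo-asc suc id 1 n (λ _ → refl)

pos-<-length : ∀ {xs y} → y ∈ xs → pos xs y < length xs
pos-<-length {x ∷ xs} {y} (here refl) rewrite ≡ᵇ-true {y} refl = z<s
pos-<-length {x ∷ xs} {y} (there y∈) with x ≡ᵇ y
... | true = z<s
... | false = s<s (pos-<-length y∈)

pos-++ˡ : ∀ xs ys {y} → y ∈ xs → pos (xs ++ ys) y ≡ pos xs y
pos-++ˡ (x ∷ xs) ys {y} (here refl) rewrite ≡ᵇ-true {y} refl = refl
pos-++ˡ (x ∷ xs) ys {y} (there y∈) with x ≡ᵇ y
... | true = refl
... | false = cong suc (pos-++ˡ xs ys y∈)

pos-++ʳ : ∀ xs ys {y} → All (_≢ y) xs → pos (xs ++ ys) y ≡ length xs + pos ys y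
pos-++ʳ [] ys _ = refl
pos-++ʳ (x ∷ xs) ys (x≢y ∷ xs∌y) rewrite ≡ᵇ-false x≢y = cong suc (pos-++ʳ xs ys xs∌y)

before-++ : ∀ xs ys {x y} → y ∈ xs → All (_≢ x) xs → pos (xs ++ ys) y < pos (xs ++ ys) x
before-++ xs ys y∈ xs∌x rewrite pos-++ˡ xs ys y∈ | pos-++ʳ xs ys xs∌x = <-≤-trans (pos-<-length y∈) (m≤m+n _ _)

before-++ˡ : ∀ xs ys {x y} → y ∈ xs → x ∈ xs → pos xs y < pos xs x → pos (xs ++ ys) y < pos (xs ++ ys) x
before-++ˡ xs ys y∈ x∈ y<x rewrite pos-++ˡ xs ys y∈ | pos-++ˡ xs ys x∈ = y<x

before-++ʳ : ∀ xs ys {x y} → All (_≢ y) xs → All (_≢ x) xs → pos ys y < pos ys x → pos (xs ++ ys) y < pos (xs ++ ys) x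
before-++ʳ xs ys xs∌y xs∌x y<x rewrite pos-++ʳ xs ys xs∌y | pos-++ʳ xs ys xs∌x = +-monoʳ-< (length xs) y<x

pos-asc : ∀ a k {y} → InRange a k y → pos (asc a k) y + a ≡ y
pos-asc a zero (l , r) = ⊥-elim (<-irrefl refl (≤-trans r (≤-trans (≤-reflexive (+-identityʳ a)) l)))
pos-asc a (suc k) {y} (l , r) with a ≟ y
... | yes refl rewrite ≡ᵇ-true {a} {a} refl = refl
... | no ne rewrite ≡ᵇ-false ne = trans (sym (+-suc _ a)) (pos-asc (suc a) k (≤∧≢⇒< l ne , subst (y <_) (+-suc a k) r))

pos-dsc : ∀ a k {y} → InRange a (suc k) y → pos (dsc a (suc k)) y + y ≡ a + k
pos-dsc a k {y} (l , r) with a + k ≟ y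
... | yes refl rewrite ≡ᵇ-true {a + k} {a + k} refl = refl
pos-dsc a zero {y} (l , r) | no ne = ⊥-elim (ne (≤-antisym (≤-trans (≤-reflexive (+-identityʳ a)) l) (≤-pred (subst (y <_) (+-suc a 0) r))))
pos-dsc a (suc k) {y} (l , r) | no ne rewrite ≡ᵇ-false ne =
  trans (cong suc (pos-dsc a k (l , ≤∧≢⇒< (≤-pred (subst (y <_) (+-suc a (suc k)) r)) (λ e → ne (sym e))))) (sym (+-suc a k))

equal-sums-< : ∀ a b c d → a + b ≡ c + d → b < d → c < a
equal-sums-< a b c d e lt = +-cancelʳ-< d c a (subst (_< a + d) e (+-monoʳ-< a lt))

asc-before : ∀ a k {x y} → InRange a k x → InRange a k y → y < x → pos (asc a k) y < pos (asc a k) x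
asc-before a k x∈ y∈ y<x = +-cancelʳ-< a _ _ (subst₂ _<_ (sym (pos-asc a k y∈)) (sym (pos-asc a k x∈)) y<x)

dsc-before : ∀ a k {x y} → InRange a k x → InRange a k y → x < y → pos (dsc a k) y < pos (dsc a k) x
dsc-before a zero (a≤x , x<a+0) _ _ = ⊥-elim (<-irrefl refl (<-≤-trans x<a+0 (subst (_≤ _) (sym (+-identityʳ a)) a≤x)))
dsc-before a (suc k) x∈ y∈ x<y = equal-sums-< _ _ _ _ (trans (pos-dsc a k x∈) (sym (pos-dsc a k y∈))) x<y

evenShape : ℕ → ℕ → List ℕ
evenShape m u = dsc (2 + m + u) m ++ asc (2 + m) u ++ dsc 1 (suc m)

oddShape : ℕ → ℕ → List ℕ
oddShape m u = asc 1 (suc m) ++ dsc (2 + m) u ++ asc (2 + m + u) (suc m)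

evenSize : ℕ → ℕ → ℕ
evenSize m u = suc (m + m + u)

oddSize : ℕ → ℕ → ℕ
oddSize m u = suc (suc (m + m + u))

module _ (m u : ℕ) where
  private
    L = dsc (2 + m + u) m
    M = asc (2 + m) u
    R = dsc 1 (suc m)
    L∌ : ∀ {z} → z < 2 + m + u → All (_≢ z) L
    L∌ z<2+m+u = ∌-outside L (dsc-inRange _ m) (inj₁ z<2+m+u)
    M∌ : ∀ {z} → z < 2 + m → All (_≢ z) M
    M∌ z<2+m = ∌-outside M (asc-inRange _ u) (inj₁ z<2+m)
    <2+m+u : ∀ {z} → z < 2 + m → z < 2 + m + u
    <2+m+u z<2+m = <-≤-trans z<2+m (m≤m+n _ u)

  evenShape-larger-first : ∀ x y → 1 ≤ x → x < 2 + m → x < y → y ≤ evenSize m u →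
    pos (evenShape m u) y < pos (evenShape m u) x
  evenShape-larger-first x y 1≤x x<2+m x<y y≤N with y <? 2 + m | y <? 2 + m + u
  ... | yes y<2+m | _ =
    before-++ʳ L (M ++ R) (L∌ (<2+m+u y<2+m)) (L∌ (<2+m+u x<2+m))
      (before-++ʳ M R (M∌ y<2+m) (M∌ x<2+m) (dsc-before 1 (suc m) (1≤x , x<2+m) (≤-trans 1≤x (<⇒≤ x<y) , y<2+m) x<y))
  ... | no y≮2+m | yes y<2+m+u =
    before-++ʳ L (M ++ R) (L∌ y<2+m+u) (L∌ (<2+m+u x<2+m)) (before-++ M R (∈-asc _ u (≮⇒≥ y≮2+m , y<2+m+u)) (M∌ x<2+m))
  ... | no _ | no y≮2+m+u =
    before-++ L (M ++ R) (∈-dsc _ m (≮⇒≥ y≮2+m+u , ≤-trans (s≤s y≤N) (≤-reflexive (size m u)))) (L∌ (<2+m+u x<2+m))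
    where
    size : ∀ m u → suc (suc m + m + u) ≡ 2 + m + u + m
    size = solve-∀

  evenShape-middle-ascending : ∀ x y → 2 + m ≤ y → y < x → x < 2 + m + u →
    pos (evenShape m u) y < pos (evenShape m u) x
  evenShape-middle-ascending x y 2+m≤y y<x x<2+m+u =
    before-++ʳ L (M ++ R) (L∌ (<-trans y<x x<2+m+u)) (L∌ x<2+m+u)
      (before-++ˡ M R (∈-asc _ u y∈) (∈-asc _ u x∈) (asc-before _ u x∈ y∈ y<x))
    where
    y∈ = 2+m≤y , <-trans y<x x<2+m+u
    x∈ = ≤-trans 2+m≤y (<⇒≤ y<x) , x<2+m+u

module _ (m u : ℕ) where
  private
    L = asc 1 (suc m)
    M = dsc (2 + m) u
    R = asc (2 + m + u) (suc m)
    L∌ : ∀ {z} → 2 + m ≤ z → All (_≢ z) L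
    L∌ 2+m≤z = ∌-outside L (asc-inRange 1 (suc m)) (inj₂ 2+m≤z)
    M∌ : ∀ {z} → 2 + m + u ≤ z → All (_≢ z) M
    M∌ 2+m+u≤z = ∌-outside M (dsc-inRange _ u) (inj₂ 2+m+u≤z)

  oddShape-smaller-first : ∀ x y → 2 + m + u ≤ x → x ≤ oddSize m u → 1 ≤ y → y < x →
    pos (oddShape m u) y < pos (oddShape m u) x
  oddShape-smaller-first x y 2+m+u≤x x≤N 1≤y y<x with y <? 2 + m | y <? 2 + m + u
  ... | yes y<2+m | _ = before-++ L (M ++ R) (∈-asc 1 (suc m) (1≤y , y<2+m)) L∌x
    where L∌x = L∌ (≤-trans (m≤m+n (2 + m) u) 2+m+u≤x)
  ... | no y≮2+m | yes y<2+m+u =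
    before-++ʳ L (M ++ R) (L∌ (≮⇒≥ y≮2+m)) (L∌ (≤-trans (m≤m+n (2 + m) u) 2+m+u≤x))
      (before-++ M R (∈-dsc _ u (≮⇒≥ y≮2+m , y<2+m+u)) (M∌ 2+m+u≤x))
  ... | no y≮2+m | no y≮2+m+u =
    before-++ʳ L (M ++ R) (L∌ (≮⇒≥ y≮2+m)) (L∌ (≤-trans (m≤m+n (2 + m) u) 2+m+u≤x))
      (before-++ʳ M R (M∌ (≮⇒≥ y≮2+m+u)) (M∌ 2+m+u≤x)
        (asc-before _ (suc m) (2+m+u≤x , x<R) (≮⇒≥ y≮2+m+u , <-trans y<x x<R) y<x))
    where
    size : ∀ m u → 3 + (m + m + u) ≡ 2 + m + u + suc m
    size = solve-∀
    x<R : x < 2 + m + u + suc m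
    x<R = ≤-trans (s≤s x≤N) (≤-reflexive (size m u))

  oddShape-middle-descending : ∀ x y → 2 + m ≤ x → x < y → y < 2 + m + u →
    pos (oddShape m u) y < pos (oddShape m u) x
  oddShape-middle-descending x y 2+m≤x x<y y<2+m+u =
    before-++ʳ L (M ++ R) (L∌ (≤-trans 2+m≤x (<⇒≤ x<y))) (L∌ 2+m≤x)
      (before-++ˡ M R (∈-dsc _ u y∈) (∈-dsc _ u x∈) (dsc-before _ u x∈ y∈ x<y))
    where
    x∈ = 2+m≤x , <-trans x<y y<2+m+u
    y∈ = ≤-trans 2+m≤x (<⇒≤ x<y) , y<2+m+u

spectrumˡ : ∀ n x B ys → Spectrum (A n x) (simValues n x (B ++ ys)) B
spectrumˡ n x B ys = Spectrum-⊆ ∈-++⁺ˡ (simValues-spectrum n x (B ++ ys))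

sfsLoop-pivot : ∀ n τ K {C ys x B φ} → τ-last τ x C → remove x C ≡ B →
  split (A n x) (simValues n x (B ++ ys)) B ≡ φ →
  sfsLoop n τ (suc K) (C ∷ map [_] ys) ≡ x ∷ sfsLoop n τ K (φ ++ map [_] ys)
sfsLoop-pivot n τ K last refl refl = sfsLoop-step n τ K _ _ _ last

-- the pivot i + 1 is τ-last in its class and cuts off the top element z, the only one with A-value i instead of i + 1
evenSweep-step : ∀ m u i w K → i ≤ m → 3 + w + (i + i) ≡ evenSize m u →
  sfsLoop (evenSize m u) (evenShape m u) (suc K) (asc (suc i) (3 + w) ∷ map [_] (asc (suc i + (3 + w)) i))
  ≡ suc i ∷ sfsLoop (evenSize m u) (evenShape m u) K (asc (2 + i) (suc w) ∷ map [_] (asc (2 + i + suc w) (suc i)))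
evenSweep-step m u i w K i≤m size =
  trans (sfsLoop-pivot N τ K last (trans (remove-head (asc-∌-below (2 + i) (2 + w) ≤-refl)) (asc-snoc (2 + i) (suc w)))
                       (split-two-descending (A N x) (here refl) (here refl) B≡ (z≡ ∷ []) ≤-refl (spectrumˡ N x (B ++ [ z ]) Rest)))
        (cong (λ v → x ∷ sfsLoop N τ K (B ∷ [ z ] ∷ map [_] (asc v i))) (shift i w))
  where
  N = evenSize m u
  τ = evenShape m u
  x = suc i
  Rest = asc (suc i + (3 + w)) i
  B = asc (2 + i) (suc w)
  z = 2 + i + suc w
  shift : ∀ i w → suc i + (3 + w) ≡ suc (2 + i + suc w)
  shift = solve-∀
  x+z : ∀ i w → suc i + (2 + i + (1 + w)) ≡ suc (3 + w + (i + i))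
  x+z = solve-∀
  top : ∀ i w → 2 + i + (2 + w) + i ≡ suc (3 + w + (i + i))
  top = solve-∀
  ≤N : ∀ {y} → y < 2 + i + (2 + w) → y ≤ N
  ≤N y< = ≤-pred (≤-trans y< (subst (2 + i + (2 + w) ≤_) (trans (top i w) (cong suc size)) (m≤m+n _ i)))
  last : τ-last τ x (asc x (3 + w))
  last = here refl , inj₁ refl ∷ All.map (λ (l , r) → inj₂ (evenShape-larger-first m u x _ (s≤s z≤n) (s≤s (s≤s i≤m)) l (≤N r))) (asc-inRange (2 + i) (2 + w))
  B≡ : All (λ y → A N x y ≡ suc i) B
  B≡ = All.map (λ {y} (l , r) → trans (A-< N x y l) (Aup-low N x y (s≤s z≤n)
         (≤-pred (subst (suc i + y <_) (trans (x+z i w) (cong suc size)) (+-monoʳ-< (suc i) r))))) (asc-inRange (2 + i) (suc w))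
  z≡ : A N x z ≡ i
  z≡ = trans (A-< N x z (s≤s (m≤m+n (suc i) _))) (Aup-n+1 N i z (trans (x+z i w) (cong suc size)))

-- the queue never holds empty classes, so asc c 0 contributes none
ascClass : ℕ → ℕ → List (List ℕ)
ascClass c zero = []
ascClass c (suc w) = [ asc c (suc w) ]

split-least-last : ∀ f {vals} w c → f c ≡ pred c → All (λ y → f y ≡ c) (asc (suc c) w) → 1 ≤ c →
  Spectrum f vals (asc c (suc w)) → split f vals (asc c (suc w)) ≡ ascClass (suc c) w ++ [ [ c ] ]
split-least-last f zero c fc≡ _ _ s = split-constant f (here refl) (fc≡ ∷ []) s
split-least-last f (suc w) (suc c) fc≡ rest≡ _ s = split-two-ascending f (here refl) (here refl) (fc≡ ∷ []) rest≡ ≤-refl s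

module _ (m u : ℕ) where
  private
    N = evenSize m u
    τ = evenShape m u

  -- each pivot d is the largest element of the class and d + c = N + 2, so the least element c is split off as a singleton
  evenSweep-tail : ∀ w c S K → 2 + m ≤ c → c + c + w ≡ 3 + N → w + length S ≤ K →
    sfsLoop N τ K (ascClass c w ++ map [_] S) ≡ dsc c w ++ S
  evenSweep-tail zero c S K _ _ len = sfsLoop-singletons N τ K S len
  evenSweep-tail (suc zero) c S (suc K) _ _ (s≤s len) =
    trans (sfsLoop-pivot N τ K (here refl , inj₁ refl ∷ []) (remove-head {c} []) (split-[] (A N c) (simValues N c S)))
          (cong₂ _∷_ (sym (+-identityʳ c)) (sfsLoop-singletons N τ K S len))
  evenSweep-tail (suc (suc w)) c S (suc K) 2+m≤c size (s≤s len) = begin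
    sfsLoop N τ (suc K) (asc c (2 + w) ∷ map [_] S)
      ≡⟨ cong (λ C → sfsLoop N τ (suc K) (C ∷ map [_] S)) (asc-snoc c (suc w)) ⟩
    sfsLoop N τ (suc K) ((B ++ [ d ]) ∷ map [_] S)
      ≡⟨ sfsLoop-pivot N τ K last (remove-last B (asc-∌-above c (suc w) ≤-refl))
                       (split-least-last (A N d) w c c≡ rest≡ (≤-trans (s≤s z≤n) 2≤c) (spectrumˡ N d B S)) ⟩
    d ∷ sfsLoop N τ K ((ascClass (suc c) w ++ [ [ c ] ]) ++ map [_] S)
      ≡⟨ cong (λ φ → d ∷ sfsLoop N τ K φ) (++-assoc (ascClass (suc c) w) [ [ c ] ] (map [_] S)) ⟩
    d ∷ sfsLoop N τ K (ascClass (suc c) w ++ map [_] (c ∷ S))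
      ≡⟨ cong (d ∷_) (evenSweep-tail w (suc c) (c ∷ S) K (≤-trans 2+m≤c (n≤1+n c)) (trans (ring₁ c w) size)
                                       (≤-trans (≤-reflexive (+-suc w (length S))) len)) ⟩
    d ∷ dsc (suc c) w ++ c ∷ S
      ≡⟨ cong (d ∷_) (trans (sym (++-assoc (dsc (suc c) w) [ c ] S)) (cong (_++ S) (sym (dsc-snoc c w)))) ⟩
    d ∷ dsc c (suc w) ++ S ∎
    where
    d = c + suc w
    B = asc c (suc w)
    ring₁ : ∀ c w → suc c + suc c + w ≡ c + c + suc (suc w)
    ring₁ = solve-∀
    ring₂ : ∀ c w → suc (c + suc w + c) ≡ c + c + suc (suc w)
    ring₂ = solve-∀
    ring₃ : ∀ m u → suc (suc (suc (m + m + u))) ≡ (suc m + u) + (2 + m)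
    ring₃ = solve-∀
    d+c : d + c ≡ suc (suc N)
    d+c = suc-injective (trans (ring₂ c w) size)
    d≤ : d ≤ suc m + u
    d≤ = +-cancelʳ-≤ (2 + m) d (suc m + u) (≤-trans (+-monoʳ-≤ d 2+m≤c) (≤-reflexive (trans d+c (ring₃ m u))))
    d≤N : d ≤ N
    d≤N = ≤-trans d≤ (≤-trans (≤-reflexive (sym (+-suc m u))) (≤-trans (m≤n+m _ m) (≤-reflexive (trans (sym (+-assoc m m (suc u))) (+-suc (m + m) u)))))
    2≤c : 2 ≤ c
    2≤c = ≤-trans (s≤s (s≤s z≤n)) 2+m≤c
    last : τ-last τ d (B ++ [ d ])
    last = ∈-++⁺ʳ B (here refl) ,
           ++⁺ (All.map (λ (yl , yr) → inj₂ (evenShape-middle-ascending m u d _ (≤-trans 2+m≤c yl) yr (s≤s d≤))) (asc-inRange c (suc w))) (inj₁ refl ∷ [])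
    c≡ : A N d c ≡ pred c
    c≡ = n+2-value (≤-trans (s≤s z≤n) 2≤c) (subst (c <_) (sym (+-suc c w)) (s≤s (m≤m+n c w))) d+c
      where
      n+2-value : ∀ {c′} → 1 ≤ c′ → c′ < d → d + c′ ≡ suc (suc N) → A N d c′ ≡ pred c′
      n+2-value {suc c′} _ c′<d d+c′ = trans (A-> N d (suc c′) c′<d) (Aup-n+2 N c′ d d≤N (trans (+-comm (suc c′) d) d+c′))
    rest≡ : All (λ y → A N d y ≡ c) (asc (suc c) w)
    rest≡ = All.map (λ {y} (yl , yr) → trans (A-> N d y (subst (y <_) (sym (+-suc c w)) yr)) (Aup-high N y d c d≤N d+c
              (≤-trans (≤-reflexive (trans (sym (cong suc d+c)) (cong suc (+-comm d c)))) (+-monoˡ-≤ d yl)))) (asc-inRange (suc c) w)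

split-two-least-last : ∀ f {vals} k c → f c ≡ pred c → f (suc c) ≡ c → All (λ y → f y ≡ suc c) (asc (2 + c) k) → 1 ≤ c →
  Spectrum f vals (asc c (2 + k)) → split f vals (asc c (2 + k)) ≡ ascClass (2 + c) k ++ [ suc c ] ∷ [ [ c ] ]
split-two-least-last f zero (suc c) c≡ sc≡ _ _ s = split-two-ascending f (here refl) (here refl) (c≡ ∷ []) (sc≡ ∷ []) ≤-refl s
split-two-least-last f (suc k) (suc c) c≡ sc≡ rest≡ _ s =
  split-three-ascending f (here refl) (here refl) (here refl) (c≡ ∷ []) (sc≡ ∷ []) rest≡ ≤-refl ≤-refl s

dsc-snoc₂ : ∀ c j → dsc c (2 + j) ≡ dsc (2 + c) j ++ suc c ∷ c ∷ []
dsc-snoc₂ c j = trans (dsc-snoc c (suc j)) (trans (cong (_++ [ c ]) (dsc-snoc (suc c) j)) (++-assoc (dsc (2 + c) j) [ suc c ] [ c ]))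

-- the first pivot d of the middle block has d + (2 + m) = N + 1, so both 2 + m and 3 + m are split off
evenSweep-middle : ∀ m u S K → 1 ≤ u → u + length S ≤ K →
  sfsLoop (evenSize m (suc u)) (evenShape m (suc u)) K (asc (2 + m) u ∷ map [_] S) ≡ dsc (2 + m) u ++ S
evenSweep-middle m 1 S K _ len = trans (sfsLoop-singletons _ _ K ((2 + m) ∷ S) len) (cong (_∷ S) (sym (+-identityʳ _)))
evenSweep-middle m 2 S (suc K) _ (s≤s len) =
  trans (sfsLoop-pivot N τ K last (remove-last [ c ] ((λ e → <-irrefl e ≤-refl) ∷ []))
                       (split-constant (A N (suc c)) (here refl) (refl ∷ []) (spectrumˡ N (suc c) [ c ] S)))
        (cong₂ _∷_ (sym (+-comm c 1)) (trans (sfsLoop-singletons N τ K (c ∷ S) len) (cong (_∷ S) (sym (+-identityʳ c)))))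
  where
  N = evenSize m 3
  τ = evenShape m 3
  c = 2 + m
  last : τ-last τ (suc c) (c ∷ suc c ∷ [])
  last = there (here refl) , inj₂ (evenShape-middle-ascending m 3 (suc c) c ≤-refl ≤-refl (subst (_< 2 + m + 3) (+-comm c 1) (+-monoʳ-< c {1} {3} (s≤s (s≤s z≤n))))) ∷ inj₁ refl ∷ []
evenSweep-middle m (suc (suc (suc k))) S (suc K) _ (s≤s len) = begin
  sfsLoop N τ (suc K) (asc c (3 + k) ∷ map [_] S)
    ≡⟨ cong (λ C → sfsLoop N τ (suc K) (C ∷ map [_] S)) (asc-snoc c (2 + k)) ⟩
  sfsLoop N τ (suc K) ((B ++ [ d ]) ∷ map [_] S)
    ≡⟨ sfsLoop-pivot N τ K last (remove-last B (asc-∌-above c (2 + k) ≤-refl))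
                     (split-two-least-last (A N d) k c c≡ sc≡ rest≡ (s≤s z≤n) (spectrumˡ N d B S)) ⟩
  d ∷ sfsLoop N τ K ((ascClass (2 + c) k ++ [ suc c ] ∷ [ [ c ] ]) ++ map [_] S)
    ≡⟨ cong (λ φ → d ∷ sfsLoop N τ K φ) (++-assoc (ascClass (2 + c) k) ([ suc c ] ∷ [ [ c ] ]) (map [_] S)) ⟩
  d ∷ sfsLoop N τ K (ascClass (2 + c) k ++ map [_] (suc c ∷ c ∷ S))
    ≡⟨ cong (d ∷_) (evenSweep-tail m (4 + k) k (2 + c) (suc c ∷ c ∷ S) K (≤-trans (n≤1+n _) (n≤1+n _)) (ring₁ m k)
                                   (≤-trans (≤-reflexive (ring₂ k (length S))) len)) ⟩
  d ∷ dsc (2 + c) k ++ suc c ∷ c ∷ S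
    ≡⟨ cong (d ∷_) (trans (sym (++-assoc (dsc (2 + c) k) (suc c ∷ c ∷ []) S)) (cong (_++ S) (sym (dsc-snoc₂ c k)))) ⟩
  d ∷ dsc c (2 + k) ++ S ∎
  where
  N = evenSize m (4 + k)
  τ = evenShape m (4 + k)
  c = 2 + m
  d = c + (2 + k)
  B = asc c (2 + k)
  ring₁ : ∀ m k → 2 + (2 + m) + (2 + (2 + m)) + k ≡ 3 + suc (m + m + (4 + k))
  ring₁ = solve-∀
  ring₂ : ∀ k L → k + (2 + L) ≡ 2 + k + L
  ring₂ = solve-∀
  d+c : ∀ m k → suc (suc m) + (2 + m + (2 + k)) ≡ suc (suc (m + m + (4 + k)))
  d+c = solve-∀
  d+c+1 : ∀ m k → suc (2 + m) + (2 + m + (2 + k)) ≡ suc (suc (suc (m + m + (4 + k))))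
  d+c+1 = solve-∀
  d+c+2 : ∀ m k → suc (suc (suc (suc (m + m + (4 + k))))) ≡ (2 + (2 + m)) + (2 + m + (2 + k))
  d+c+2 = solve-∀
  d+3+m : ∀ m k → 2 + m + (2 + k) + suc (2 + m) ≡ suc (suc (suc (m + m + (4 + k))))
  d+3+m = solve-∀
  d+m : ∀ m k → 2 + m + (2 + k) + suc m ≡ suc (m + m + (4 + k))
  d+m = solve-∀
  d+2 : ∀ m k → suc (suc (2 + m + (2 + k))) ≡ 2 + m + (4 + k)
  d+2 = solve-∀
  c+2+k : ∀ c k → 2 + c + k ≡ c + (2 + k)
  c+2+k = solve-∀
  d≤N : d ≤ N
  d≤N = subst (d ≤_) (d+m m k) (m≤m+n _ (suc m))
  sc<d : suc c < d
  sc<d = subst (suc c <_) (c+2+k c k) (s≤s (s≤s (m≤m+n c k)))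
  c≡ : A N d c ≡ suc m
  c≡ = trans (A-> N d c (<-trans ≤-refl sc<d)) (Aup-n+1 N (suc m) d (d+c m k))
  sc≡ : A N d (suc c) ≡ c
  sc≡ = trans (A-> N d (suc c) sc<d) (Aup-n+2 N c d d≤N (d+c+1 m k))
  rest≡ : All (λ y → A N d y ≡ suc c) (asc (2 + c) k)
  rest≡ = All.map (λ {y} (yl , yr) → trans (A-> N d y (subst (y <_) (c+2+k c k) yr))
                   (Aup-high N y d (suc c) d≤N (d+3+m m k) (≤-trans (≤-reflexive (d+c+2 m k)) (+-monoˡ-≤ d yl)))) (asc-inRange (2 + c) k)
  last : τ-last τ d (B ++ [ d ])
  last = ∈-++⁺ʳ B (here refl) ,
         ++⁺ (All.map (λ (yl , yr) → inj₂ (evenShape-middle-ascending m (4 + k) d _ yl yr (subst (d <_) (d+2 m k) (n≤1+n _)))) (asc-inRange c (2 + k))) (inj₁ refl ∷ [])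

module _ (m v : ℕ) where
  private
    N = evenSize m (2 + v)
    τ = evenShape m (2 + v)

  evenSweep-prefix : ∀ j i K → i + j ≡ suc m →
    sfsLoop N τ (j + K) (asc (suc i) (j + j + suc v) ∷ map [_] (asc (suc i + (j + j + suc v)) i))
    ≡ asc (suc i) j ++ sfsLoop N τ K (asc (2 + m) (suc v) ∷ map [_] (asc (2 + m + suc v) (suc m)))
  evenSweep-prefix zero i K i≡ rewrite +-identityʳ i | i≡ = refl
  evenSweep-prefix (suc j) i K i+j≡ =
    trans (cong₂ (λ a b → sfsLoop N τ (suc (j + K)) (asc (suc i) a ∷ map [_] (asc b i))) (ring₁ j v) (sym (ring₂ i j v)))
     (trans (evenSweep-step m (2 + v) i (j + j + v) (j + K) i≤m size)
       (cong (suc i ∷_) (trans (cong₂ (λ a b → sfsLoop N τ (j + K) (asc (2 + i) a ∷ map [_] (asc b (suc i)))) (ring₃ j v) (ring₄ i j v))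
         (evenSweep-prefix j (suc i) K (trans (sym (+-suc i j)) i+j≡)))))
    where
    ring₁ : ∀ j v → suc j + suc j + suc v ≡ 3 + (j + j + v)
    ring₁ = solve-∀
    ring₂ : ∀ i j v → suc i + (3 + (j + j + v)) ≡ suc i + (suc j + suc j + suc v)
    ring₂ = solve-∀
    ring₃ : ∀ j v → suc (j + j + v) ≡ j + j + suc v
    ring₃ = solve-∀
    ring₄ : ∀ i j v → 2 + i + suc (j + j + v) ≡ suc (suc i) + (j + j + suc v)
    ring₄ = solve-∀
    ring₅ : ∀ i j v → 3 + (j + j + v) + (i + i) ≡ suc ((i + j) + (i + j) + (2 + v))
    ring₅ = solve-∀
    m≡ : m ≡ i + j
    m≡ = suc-injective (trans (sym i+j≡) (+-suc i j))
    i≤m : i ≤ m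
    i≤m = subst (i ≤_) (sym m≡) (m≤m+n i j)
    size : 3 + (j + j + v) + (i + i) ≡ N
    size rewrite m≡ = ring₅ i j v

SFS+-evenShape : ∀ m v {n} → n ≡ evenSize m (2 + v) → SFS+ n (evenShape m (2 + v)) ≡ oddShape m (suc v)
SFS+-evenShape m v refl = begin
  sfsLoop N τ N [ vertices N ]                              ≡⟨ cong (λ V → sfsLoop N τ N [ V ]) (vertices-asc N) ⟩
  sfsLoop N τ N [ asc 1 N ]                                 ≡⟨ cong (λ k → sfsLoop N τ k [ asc 1 N ]) (ring₁ m v) ⟩
  sfsLoop N τ (suc m + K) [ asc 1 N ]                       ≡⟨ cong (λ k → sfsLoop N τ (suc m + K) [ asc 1 k ]) (ring₂ m v) ⟩
  sfsLoop N τ (suc m + K) [ asc 1 (suc m + suc m + suc v) ] ≡⟨ evenSweep-prefix m v (suc m) 0 K refl ⟩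
  asc 1 (suc m) ++ sfsLoop N τ K (asc (2 + m) (suc v) ∷ map [_] S)
                                                            ≡⟨ cong (asc 1 (suc m) ++_) (evenSweep-middle m (suc v) S K (s≤s z≤n) len) ⟩
  asc 1 (suc m) ++ dsc (2 + m) (suc v) ++ S                 ∎
  where
  N = evenSize m (2 + v)
  τ = evenShape m (2 + v)
  K = suc m + suc v
  S = asc (2 + m + suc v) (suc m)
  ring₁ : ∀ m v → suc (m + m + (2 + v)) ≡ suc m + (suc m + suc v)
  ring₁ = solve-∀
  ring₂ : ∀ m v → suc (m + m + (2 + v)) ≡ suc m + suc m + suc v
  ring₂ = solve-∀
  len : suc v + length S ≤ K
  len = ≤-reflexive (trans (cong (suc v +_) (length-asc _ (suc m))) (+-comm (suc v) (suc m)))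

module _ (m v : ℕ) where
  private
    u = 2 + v
    N = oddSize m u
    τ = oddShape m u
    W = m + m + suc v
    N≡ : N ≡ 3 + W
    N≡ = ring m v
      where
      ring : ∀ m v → suc (suc (m + m + (2 + v))) ≡ 3 + (m + m + suc v)
      ring = solve-∀

  -- the first pivot is N, and A N N y = 2 for every y ≥ 3
  oddSweep-first : ∀ K → sfsLoop N τ (suc K) [ asc 1 N ] ≡ N ∷ sfsLoop N τ K (asc 3 W ∷ map [_] (dsc 1 2))
  oddSweep-first K =
    trans (cong (λ C → sfsLoop N τ (suc K) [ C ]) (trans (cong (asc 1) N≡) (trans (asc-snoc 1 (2 + W)) (cong (λ z → B ++ [ z ]) (sym N≡)))))
          (sfsLoop-pivot N τ K {ys = []} last (remove-last B (asc-∌-above 1 (2 + W) (≤-reflexive (sym N≡)))) split≡)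
    where
    B = asc 1 (2 + W)
    0<W : 0 < W
    0<W = ≤-trans (s≤s z≤n) (m≤n+m (suc v) (m + m))
    2<N : 2 < N
    2<N = subst (2 <_) (sym N≡) (s≤s (s≤s (s≤s z≤n)))
    ring : ∀ m v → 2 + m + (2 + v) + m ≡ suc (suc (m + m + (2 + v)))
    ring = solve-∀
    last : τ-last τ N (B ++ [ N ])
    last = ∈-++⁺ʳ B (here refl) ,
           ++⁺ (All.map (λ {y} (yl , yr) → inj₂ (oddShape-smaller-first m u N y (subst (2 + m + u ≤_) (ring m v) (m≤m+n _ m)) ≤-refl yl (subst (y <_) (sym N≡) yr)))
                        (asc-inRange 1 (2 + W)))
               (inj₁ refl ∷ [])
    split≡ : split (A N N) (simValues N N (B ++ [])) B ≡ asc 3 W ∷ [ 2 ] ∷ [ 1 ] ∷ []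
    split≡ = split-three-ascending (A N N) {B₁ = [ 1 ]} {B₂ = [ 2 ]} {B₃ = asc 3 W} (here refl) (here refl) (∈-asc 3 W (≤-refl , +-monoʳ-< 3 0<W))
               (trans (A-> N N 1 (<-trans ≤-refl 2<N)) (Aup-n+1 N 0 N refl) ∷ []) (trans (A-> N N 2 2<N) (Aup-n+2 N 1 N ≤-refl refl) ∷ [])
               (All.map (λ {y} (yl , yr) → trans (A-> N N y (subst (y <_) (sym N≡) yr)) (Aup-high N y N 2 ≤-refl (+-comm N 2) (+-monoˡ-≤ N yl))) (asc-inRange 3 W))
               (s≤s z≤n) ≤-refl (spectrumˡ N N B [])

  oddSweep-step : ∀ i w K → i ≤ m → (2 + i) + (2 + w) + i ≡ N →
    sfsLoop N τ (suc K) (asc (2 + i) (3 + w) ∷ map [_] (dsc 1 (suc i)))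
    ≡ (2 + i + (2 + w)) ∷ sfsLoop N τ K (asc (3 + i) (suc w) ∷ map [_] (dsc 1 (2 + i)))
  oddSweep-step i w K i≤m size =
    trans (cong (λ C → sfsLoop N τ (suc K) (C ∷ map [_] Rest)) (asc-snoc (2 + i) (2 + w)))
     (sfsLoop-pivot N τ K last (remove-last B (asc-∌-above (2 + i) (2 + w) ≤-refl))
        (split-two-ascending (A N p) (here refl) (here refl) (least≡ ∷ []) rest≡ ≤-refl (spectrumˡ N p B Rest)))
    where
    Rest = dsc 1 (suc i)
    B = asc (2 + i) (2 + w)
    p = 2 + i + (2 + w)
    ring₁ : ∀ i w → suc (suc i) + (2 + i + (2 + w)) ≡ suc (suc ((2 + i) + (2 + w) + i))
    ring₁ = solve-∀
    ring₂ : ∀ i w → 2 + i + (2 + w) + (2 + i) ≡ suc (suc ((2 + i) + (2 + w) + i))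
    ring₂ = solve-∀
    ring₃ : ∀ i w → 3 + i + (2 + i + (2 + w)) ≡ suc (suc (suc ((2 + i) + (2 + w) + i)))
    ring₃ = solve-∀
    ring₄ : ∀ i w → 3 + i + suc w ≡ 2 + i + (2 + w)
    ring₄ = solve-∀
    ring₅ : ∀ m u → suc (suc (m + m + u)) ≡ 2 + m + u + m
    ring₅ = solve-∀
    p≤N : p ≤ N
    p≤N = subst (p ≤_) size (m≤m+n p i)
    R≤p : 2 + m + u ≤ p
    R≤p = +-cancelʳ-≤ m (2 + m + u) p (≤-trans (≤-reflexive (trans (sym (ring₅ m u)) (sym size))) (+-monoʳ-≤ p i≤m))
    last : τ-last τ p (B ++ [ p ])
    last = ∈-++⁺ʳ B (here refl) ,
           ++⁺ (All.map (λ (yl , yr) → inj₂ (oddShape-smaller-first m u p _ R≤p p≤N (≤-trans (s≤s z≤n) yl) yr)) (asc-inRange (2 + i) (2 + w))) (inj₁ refl ∷ [])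
    least≡ : A N p (2 + i) ≡ suc i
    least≡ = trans (A-> N p (2 + i) (s≤s (s≤s (≤-trans (s≤s (m≤m+n i (suc w))) (≤-reflexive (sym (+-suc i (suc w))))))))
                   (Aup-n+2 N (suc i) p p≤N (trans (ring₁ i w) (cong (suc ∘ suc) size)))
    rest≡ : All (λ y → A N p y ≡ 2 + i) (asc (3 + i) (suc w))
    rest≡ = All.map (λ {y} (yl , yr) → trans (A-> N p y (subst (y <_) (ring₄ i w) yr))
              (Aup-high N y p (2 + i) p≤N (trans (ring₂ i w) (cong (suc ∘ suc) size))
                (≤-trans (≤-reflexive (sym (trans (ring₃ i w) (cong (suc ∘ suc ∘ suc) size)))) (+-monoˡ-≤ p yl)))) (asc-inRange (3 + i) (suc w))

  oddSweep-prefix : ∀ j i K → i + j ≡ suc m →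
    sfsLoop N τ (j + K) (asc (2 + i) (j + j + suc v) ∷ map [_] (dsc 1 (suc i)))
    ≡ dsc (3 + m + suc v) j ++ sfsLoop N τ K (asc (3 + m) (suc v) ∷ map [_] (dsc 1 (2 + m)))
  oddSweep-prefix zero i K i≡ rewrite +-identityʳ i | i≡ = refl
  oddSweep-prefix (suc j) i K i+j≡ =
    trans (cong (λ a → sfsLoop N τ (suc (j + K)) (asc (2 + i) a ∷ map [_] (dsc 1 (suc i)))) (ring₁ j v))
     (trans (oddSweep-step i (j + j + v) (j + K) i≤m size)
       (cong₂ _∷_ p≡ (trans (cong (λ a → sfsLoop N τ (j + K) (asc (3 + i) a ∷ map [_] (dsc 1 (2 + i)))) (ring₂ j v))
          (oddSweep-prefix j (suc i) K (trans (sym (+-suc i j)) i+j≡)))))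
    where
    ring₁ : ∀ j v → suc j + suc j + suc v ≡ 3 + (j + j + v)
    ring₁ = solve-∀
    ring₂ : ∀ j v → suc (j + j + v) ≡ j + j + suc v
    ring₂ = solve-∀
    ring₃ : ∀ i j v → (2 + i) + (2 + (j + j + v)) + i ≡ suc (suc ((i + j) + (i + j) + (2 + v)))
    ring₃ = solve-∀
    ring₄ : ∀ i j v → 2 + i + (2 + (j + j + v)) ≡ 3 + (i + j) + suc v + j
    ring₄ = solve-∀
    m≡ : m ≡ i + j
    m≡ = suc-injective (trans (sym i+j≡) (+-suc i j))
    i≤m : i ≤ m
    i≤m = subst (i ≤_) (sym m≡) (m≤m+n i j)
    size : (2 + i) + (2 + (j + j + v)) + i ≡ N
    size rewrite m≡ = ring₃ i j v
    p≡ : 2 + i + (2 + (j + j + v)) ≡ 3 + m + suc v + j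
    p≡ rewrite m≡ = ring₄ i j v

  antitone-asc : ∀ a b k → 1 ≤ a → a < b → b + k ≤ suc N → AllPairs (_≥_ on A N a) (asc b k)
  antitone-asc a b zero _ _ _ = []
  antitone-asc a b (suc k) 1≤a a<b b+k≤ =
    All.map (λ {y} (yl , yr) → subst₂ _≤_ (sym (trans (A-< N a y (<-trans a<b yl)) (Aup-rowValue N a y 1≤a (y≤N yr))))
                                       (sym (trans (A-< N a b a<b) (Aup-rowValue N a b 1≤a (≤-trans (<⇒≤ yl) (y≤N yr)))))
                                       (rowValue-antitoneʳ N a (<⇒≤ yl)))
            (asc-inRange (suc b) k)
    ∷ antitone-asc a (suc b) k 1≤a (<-trans a<b ≤-refl) (≤-trans (≤-reflexive (sym (+-suc b k))) b+k≤)
    where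
    y≤N : ∀ {y} → y < suc b + k → y ≤ N
    y≤N y< = ≤-pred (≤-trans y< (≤-trans (≤-reflexive (sym (+-suc b k))) b+k≤))

  sweepable-asc : ∀ a k → 2 + m ≤ a → a + k ≤ 2 + m + u → Sweepable N τ (asc a k)
  sweepable-asc a zero _ _ = tt
  sweepable-asc a (suc k) 2+m≤a a+k≤ =
    All.map (λ (yl , yr) → oddShape-middle-descending m u a _ 2+m≤a yl (<-≤-trans yr (≤-trans (≤-reflexive (sym (+-suc a k))) a+k≤))) (asc-inRange (suc a) k) ,
    antitone-asc a (suc a) k (≤-trans (s≤s z≤n) 2+m≤a) ≤-refl
                 (≤-trans (≤-trans (≤-reflexive (sym (+-suc a k))) a+k≤) (subst (2 + m + u ≤_) (ring m u) (m≤m+n _ (suc m)))) ,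
    sweepable-asc (suc a) k (≤-trans 2+m≤a (n≤1+n a)) (≤-trans (≤-reflexive (sym (+-suc a k))) a+k≤)
    where
    ring : ∀ m u → 2 + m + u + suc m ≡ suc (suc (suc (m + m + u)))
    ring = solve-∀

  oddSweep-rest : ∀ K → suc v + (2 + m) ≤ K →
    sfsLoop N τ K (asc (3 + m) (suc v) ∷ map [_] (dsc 1 (2 + m))) ≡ asc (3 + m) (suc v) ++ dsc 1 (2 + m)
  oddSweep-rest K len =
    sfsLoop-sweep N τ [ asc (3 + m) (suc v) ] (dsc 1 (2 + m)) K (++-identityʳ _) (tt ∷ [])
      (sweepable-asc (3 + m) (suc v) (n≤1+n _) (≤-reflexive (ring m v)))
      (≤-trans (≤-reflexive (cong₂ _+_ (length-asc (3 + m) (suc v)) (length-dsc 1 (2 + m)))) len)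
    where
    ring : ∀ m v → 3 + m + suc v ≡ 2 + m + (2 + v)
    ring = solve-∀

SFS+-oddShape : ∀ m v {n} → n ≡ oddSize m (2 + v) → SFS+ n (oddShape m (2 + v)) ≡ evenShape (suc m) (suc v)
SFS+-oddShape m v refl = begin
  sfsLoop N τ N [ vertices N ]                 ≡⟨ cong (λ V → sfsLoop N τ N [ V ]) (vertices-asc N) ⟩
  sfsLoop N τ N [ asc 1 N ]                    ≡⟨ cong (λ k → sfsLoop N τ k [ asc 1 N ]) (ring₁ m v) ⟩
  sfsLoop N τ (suc (m + K)) [ asc 1 N ]        ≡⟨ oddSweep-first m v (m + K) ⟩
  N ∷ sfsLoop N τ (m + K) (asc 3 (m + m + suc v) ∷ map [_] (dsc 1 2))
                                               ≡⟨ cong₂ _∷_ (ring₂ m v) (oddSweep-prefix m v m 1 K refl) ⟩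
  (3 + m + suc v + m) ∷ dsc (3 + m + suc v) m ++ sfsLoop N τ K (asc (3 + m) (suc v) ∷ map [_] (dsc 1 (2 + m)))
                                               ≡⟨ cong (λ rest → (3 + m + suc v + m) ∷ dsc (3 + m + suc v) m ++ rest) (oddSweep-rest m v K ≤-refl) ⟩
  evenShape (suc m) (suc v)                    ∎
  where
  N = oddSize m (2 + v)
  τ = oddShape m (2 + v)
  K = suc v + (2 + m)
  ring₁ : ∀ m v → suc (suc (m + m + (2 + v))) ≡ suc (m + (suc v + (2 + m)))
  ring₁ = solve-∀
  ring₂ : ∀ m v → suc (suc (m + m + (2 + v))) ≡ 3 + m + suc v + m
  ring₂ = solve-∀

lookup-at : ∀ (π P : List ℕ) x R i (p : i < length π) → π ≡ P ++ x ∷ R → length P ≡ i → lookup π (fromℕ< p) ≡ x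
lookup-at .(x ∷ R) [] x R zero p refl refl = refl
lookup-at .(y ∷ P ++ x ∷ R) (y ∷ P) x R (suc i) p refl e = lookup-at (P ++ x ∷ R) P x R i (s<s⁻¹ p) refl (suc-injective e)

lookup-asc : ∀ a k (i : Fin (length (asc a k))) → lookup (asc a k) i ≡ a + toℕ i
lookup-asc a zero ()
lookup-asc a (suc k) Fin.zero = sym (+-identityʳ a)
lookup-asc a (suc k) (Fin.suc i) = trans (lookup-asc (suc a) k i) (sym (+-suc a (toℕ i)))

lookup-dsc : ∀ a k (i : Fin (length (dsc a (suc k)))) → lookup (dsc a (suc k)) i + toℕ i ≡ a + k
lookup-dsc a k Fin.zero = +-identityʳ _
lookup-dsc a zero (Fin.suc ())
lookup-dsc a (suc k) (Fin.suc i) = trans (+-suc _ (toℕ i)) (trans (cong suc (lookup-dsc a k i)) (sym (+-suc a k)))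

robinson-asc : ∀ n → Robinson n (asc 1 n)
robinson-asc n a b c a<b b<c rewrite lookup-asc 1 n a | lookup-asc 1 n b | lookup-asc 1 n c =
  A-robinson-triple n _ _ _ (s≤s z≤n) (s≤s a<b) (s≤s b<c) (subst (suc (toℕ c) ≤_) (length-asc 1 n) (toℕ<n c))

robinson-dsc : ∀ n → Robinson n (dsc 1 n)
robinson-dsc zero ()
robinson-dsc (suc k) a b c ab bc =
  subst₂ _≤_ (A-sym n Z X) (trans (⊓-comm (A n Z Y) (A n Y X)) (cong₂ _⊓_ (A-sym n Y X) (A-sym n Z Y)))
    (A-robinson-triple n Z Y X Z1 ZY YX Xn)
  where
  n = suc k
  X = lookup (dsc 1 (suc k)) a
  Y = lookup (dsc 1 (suc k)) b
  Z = lookup (dsc 1 (suc k)) c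
  hX = lookup-dsc 1 k a
  hY = lookup-dsc 1 k b
  hZ = lookup-dsc 1 k c
  YX : Y < X
  YX = equal-sums-< X (toℕ a) Y (toℕ b) (trans hX (sym hY)) ab
  ZY : Z < Y
  ZY = equal-sums-< Y (toℕ b) Z (toℕ c) (trans hY (sym hZ)) bc
  Xn : X ≤ n
  Xn = subst (X ≤_) hX (m≤m+n X (toℕ a))
  Z1 : 1 ≤ Z
  Z1 with Z | hZ | toℕ<n c
  ... | zero | h | lt = ⊥-elim (<-irrefl h (subst (toℕ c <_) (length-dsc 1 (suc k)) lt))
  ... | suc _ | _ | _ = s≤s z≤n

¬robinson-triple : ∀ n π P x Q y R z S → π ≡ P ++ x ∷ Q ++ y ∷ R ++ z ∷ S → A n x y ⊓ A n y z < A n x z → ¬ Robinson n π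
¬robinson-triple n π P x Q y R z S e lt rob =
  <-irrefl refl (<-≤-trans lt (conv _ _ _ lx ly lz (rob fi fj fk ij jk)))
  where
  conv : ∀ a b c → a ≡ x → b ≡ y → c ≡ z → A n a c ≤ A n a b ⊓ A n b c → A n x z ≤ A n x y ⊓ A n y z
  conv a b c refl refl refl h = h
  i = length P
  j = length (P ++ x ∷ Q)
  k = length ((P ++ x ∷ Q) ++ y ∷ R)
  e2 : π ≡ (P ++ x ∷ Q) ++ y ∷ R ++ z ∷ S
  e2 = trans e (sym (++-assoc P (x ∷ Q) (y ∷ R ++ z ∷ S)))
  e3 : π ≡ ((P ++ x ∷ Q) ++ y ∷ R) ++ z ∷ S
  e3 = trans e2 (sym (++-assoc (P ++ x ∷ Q) (y ∷ R) (z ∷ S)))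
  kl : k < length π
  kl = subst (k <_) (sym (cong length e3)) (subst (k <_) (sym (length-++ ((P ++ x ∷ Q) ++ y ∷ R) {z ∷ S})) (m<m+n k (s≤s z≤n)))
  jk' : j < k
  jk' = subst (j <_) (sym (length-++ (P ++ x ∷ Q) {y ∷ R})) (m<m+n j (s≤s z≤n))
  ij' : i < j
  ij' = subst (i <_) (sym (length-++ P {x ∷ Q})) (m<m+n i (s≤s z≤n))
  jl = <-trans jk' kl
  il = <-trans ij' jl
  fi = fromℕ< il
  fj = fromℕ< jl
  fk = fromℕ< kl
  ij : fi Fin.< fj
  ij = subst₂ _<_ (sym (toℕ-fromℕ< il)) (sym (toℕ-fromℕ< jl)) ij'
  jk : fj Fin.< fk
  jk = subst₂ _<_ (sym (toℕ-fromℕ< jl)) (sym (toℕ-fromℕ< kl)) jk'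
  lx : lookup π fi ≡ x
  lx = lookup-at π P x _ i il e refl
  ly : lookup π fj ≡ y
  ly = lookup-at π (P ++ x ∷ Q) y _ j jl e2 refl
  lz : lookup π fk ≡ z
  lz = lookup-at π ((P ++ x ∷ Q) ++ y ∷ R) z S k kl e3 refl

¬robinson-evenShape : ∀ m v → ¬ Robinson (evenSize m (2 + v)) (evenShape m (2 + v))
¬robinson-evenShape m v = ¬robinson-triple n (evenShape m u) P (2 + m) Q (3 + m + v) [] (suc m) S split≡ lt
  where
  u = 2 + v
  n = evenSize m u
  P = dsc (2 + m + u) m
  Q = asc (3 + m) v
  S = dsc 1 m
  ring₁ : ∀ m v → suc (suc m) + (3 + m + v) ≡ suc (suc (suc (m + m + (2 + v))))
  ring₁ = solve-∀
  ring₂ : ∀ m v → suc m + (3 + m + v) ≡ suc (suc (m + m + (2 + v)))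
  ring₂ = solve-∀
  ring₃ : ∀ m v → suc m + (2 + m) + v ≡ suc (m + m + (2 + v))
  ring₃ = solve-∀
  ring₄ : ∀ m v → 3 + m + v + m ≡ suc (m + m + (2 + v))
  ring₄ = solve-∀
  split≡ : evenShape m u ≡ P ++ (2 + m) ∷ Q ++ (3 + m + v) ∷ [] ++ suc m ∷ S
  split≡ = cong (λ w → P ++ (2 + m) ∷ w) (trans (cong (_++ suc m ∷ S) (asc-snoc (3 + m) v)) (++-assoc Q [ 3 + m + v ] (suc m ∷ S)))
  xy≡ : A n (2 + m) (3 + m + v) ≡ suc m
  xy≡ = trans (A-< n (2 + m) (3 + m + v) (s≤s (s≤s (s≤s (m≤m+n m v)))))
              (Aup-n+2 n (suc m) (3 + m + v) (subst (3 + m + v ≤_) (ring₄ m v) (m≤m+n _ m)) (ring₁ m v))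
  yz≡ : A n (3 + m + v) (suc m) ≡ m
  yz≡ = trans (A-> n (3 + m + v) (suc m) (s≤s (s≤s (≤-trans (m≤m+n m v) (n≤1+n _))))) (Aup-n+1 n m (3 + m + v) (ring₂ m v))
  xz≡ : A n (2 + m) (suc m) ≡ suc m
  xz≡ = trans (A-> n (2 + m) (suc m) ≤-refl) (Aup-low n (suc m) (2 + m) (s≤s z≤n) (subst (suc m + (2 + m) ≤_) (ring₃ m v) (m≤m+n _ v)))
  lt : A n (2 + m) (3 + m + v) ⊓ A n (3 + m + v) (suc m) < A n (2 + m) (suc m)
  lt rewrite xy≡ | yz≡ | xz≡ = s≤s (m⊓n≤n (suc m) m)

¬robinson-oddShape : ∀ m v → ¬ Robinson (oddSize m (2 + v)) (oddShape m (2 + v))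
¬robinson-oddShape m v = ¬robinson-triple n (oddShape m u) P x Q (2 + m) [] z S split≡ lt
  where
  u = 2 + v
  n = oddSize m u
  P = asc 1 (suc m)
  x = 2 + m + suc v
  Q = dsc (3 + m) v
  z = 2 + m + u
  S = asc (suc z) m
  ring₁ : ∀ m v → suc (suc m) + (2 + m + suc v) ≡ suc (suc (suc (m + m + (2 + v))))
  ring₁ = solve-∀
  ring₂ : ∀ m v → suc (suc m) + (2 + m + (2 + v)) ≡ suc (suc (suc (suc (m + m + (2 + v)))))
  ring₂ = solve-∀
  ring₃ : ∀ m v → 2 + m + (2 + v) + (2 + m) ≡ suc (suc (suc (suc (m + m + (2 + v)))))
  ring₃ = solve-∀
  ring₄ : ∀ m v → 2 + m + (2 + v) + m ≡ suc (suc (m + m + (2 + v)))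
  ring₄ = solve-∀
  ring₅ : ∀ m v → suc (suc (suc (suc (suc (m + m + (2 + v)))))) + v ≡ 2 + m + suc v + (2 + m + (2 + v))
  ring₅ = solve-∀
  split≡ : oddShape m u ≡ P ++ x ∷ Q ++ (2 + m) ∷ [] ++ z ∷ S
  split≡ = cong (λ w → P ++ x ∷ w) (trans (cong (_++ z ∷ S) (dsc-snoc (2 + m) v)) (++-assoc Q [ 2 + m ] (z ∷ S)))
  z≤N : z ≤ n
  z≤N = subst (z ≤_) (ring₄ m v) (m≤m+n _ m)
  y<x : 2 + m < x
  y<x = s≤s (s≤s (subst (suc m ≤_) (sym (+-suc m v)) (s≤s (m≤m+n m v))))
  x<z : x < z
  x<z = subst (x <_) (sym (+-suc (2 + m) (suc v))) ≤-refl
  xy≡ : A n x (2 + m) ≡ suc m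
  xy≡ = trans (A-> n x (2 + m) y<x) (Aup-n+1 n (suc m) x (ring₁ m v))
  yz≡ : A n (2 + m) z ≡ suc m
  yz≡ = trans (A-< n (2 + m) z (<-trans y<x x<z)) (Aup-n+2 n (suc m) z z≤N (ring₂ m v))
  xz≡ : A n x z ≡ 2 + m
  xz≡ = trans (A-< n x z x<z) (Aup-high n x z (2 + m) z≤N (ring₃ m v) (subst (suc (suc (suc n)) ≤_) (ring₅ m v) (m≤m+n _ v)))
  lt : A n x (2 + m) ⊓ A n (2 + m) z < A n x z
  lt rewrite xy≡ | yz≡ | xz≡ = s≤s (m⊓n≤n (suc m) (suc m))

σ-even : ∀ m v n → n ≡ evenSize m (suc v) → σ n (m + m) ≡ evenShape m (suc v)
σ-even zero v n refl = cong (_++ [ 1 ]) (map-applyUpTo-asc (suc ∘ suc) id 2 (suc v) (λ _ → refl))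
σ-even (suc m) v n n≡ = begin
  σ n (suc m + suc m)                      ≡⟨ cong (σ n ∘ suc) (+-suc m m) ⟩
  SFS+ n (SFS+ n (σ n (m + m)))            ≡⟨ cong (SFS+ n ∘ SFS+ n) (σ-even m (2 + v) n (trans n≡ (ring₁ m v))) ⟩
  SFS+ n (SFS+ n (evenShape m (3 + v)))    ≡⟨ cong (SFS+ n) (SFS+-evenShape m (suc v) (trans n≡ (ring₁ m v))) ⟩
  SFS+ n (oddShape m (2 + v))              ≡⟨ SFS+-oddShape m v (trans n≡ (ring₂ m v)) ⟩
  evenShape (suc m) (suc v)                ∎
  where
  ring₁ : ∀ m v → suc (suc m + suc m + suc v) ≡ suc (m + m + (3 + v))
  ring₁ = solve-∀
  ring₂ : ∀ m v → suc (suc m + suc m + suc v) ≡ suc (suc (m + m + (2 + v)))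
  ring₂ = solve-∀

σ-odd : ∀ m v n → n ≡ oddSize m (suc v) → σ n (suc (m + m)) ≡ oddShape m (suc v)
σ-odd m v n n≡ = trans (cong (SFS+ n) (σ-even m (suc v) n n≡even)) (SFS+-evenShape m v n≡even)
  where
  ring : ∀ m v → suc (suc (m + m + suc v)) ≡ suc (m + m + (2 + v))
  ring = solve-∀
  n≡even = trans n≡ (ring m v)

half : ∀ k → Σ ℕ (λ m → k ≡ m + m ⊎ k ≡ suc (m + m))
half zero = 0 , inj₁ refl
half (suc k) with half k
... | m , inj₁ k≡ = m , inj₂ (cong suc k≡)
... | m , inj₂ k≡ = suc m , inj₁ (trans (cong suc k≡) (cong suc (sym (+-suc m m))))

evenShape-sorted : ∀ m → evenShape m 1 ≡ dsc 1 (evenSize m 1)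
evenShape-sorted m =
  trans (cong (λ a → dsc a m ++ (2 + m) ∷ dsc 1 (suc m)) (+-comm (2 + m) 1))
        (trans (sym (dsc-++ 1 (2 + m) m)) (cong (dsc 1) (ring m)))
  where
  ring : ∀ m → m + (2 + m) ≡ suc (m + m + 1)
  ring = solve-∀

oddShape-sorted : ∀ m → oddShape m 1 ≡ asc 1 (oddSize m 1)
oddShape-sorted m =
  trans (cong₂ (λ z a → asc 1 (suc m) ++ z ∷ asc a (suc m)) (+-identityʳ (2 + m)) (+-comm (2 + m) 1))
        (trans (sym (asc-++ 1 (suc m) (suc (suc m)))) (cong (asc 1) (ring m)))
  where
  ring : ∀ m → suc m + suc (suc m) ≡ suc (suc (m + m + 1))
  ring = solve-∀

σ-last-sorted : ∀ t → σ (3 + t) (suc t) ≡ dsc 1 (3 + t) ⊎ σ (3 + t) (suc t) ≡ asc 1 (3 + t)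
σ-last-sorted t with half (suc t)
... | m , inj₁ t≡ = inj₁ (begin
  σ (3 + t) (suc t)       ≡⟨ cong (σ (3 + t)) t≡ ⟩
  σ (3 + t) (m + m)       ≡⟨ σ-even m 0 (3 + t) n≡ ⟩
  evenShape m 1           ≡⟨ evenShape-sorted m ⟩
  dsc 1 (evenSize m 1)    ≡⟨ cong (dsc 1) (sym n≡) ⟩
  dsc 1 (3 + t)           ∎)
  where
  ring : ∀ m → suc (suc (m + m)) ≡ suc (m + m + 1)
  ring = solve-∀
  n≡ = trans (cong (suc ∘ suc) t≡) (ring m)
... | m , inj₂ t≡ = inj₂ (begin
  σ (3 + t) (suc t)       ≡⟨ cong (σ (3 + t)) t≡ ⟩
  σ (3 + t) (suc (m + m)) ≡⟨ σ-odd m 0 (3 + t) n≡ ⟩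
  oddShape m 1            ≡⟨ oddShape-sorted m ⟩
  asc 1 (oddSize m 1)     ≡⟨ cong (asc 1) (sym n≡) ⟩
  asc 1 (3 + t)           ∎)
  where
  ring : ∀ m → suc (suc (suc (m + m))) ≡ suc (suc (m + m + 1))
  ring = solve-∀
  n≡ = trans (cong (suc ∘ suc) t≡) (ring m)

robinson-σ-last : ∀ t → Robinson (3 + t) (σ (3 + t) (suc t))
robinson-σ-last t with σ-last-sorted t
... | inj₁ σ≡ = subst (Robinson (3 + t)) (sym σ≡) (robinson-dsc (3 + t))
... | inj₂ σ≡ = subst (Robinson (3 + t)) (sym σ≡) (robinson-asc (3 + t))

¬robinson-σ-early : ∀ t j → j < suc t → ¬ Robinson (3 + t) (σ (3 + t) j)
¬robinson-σ-early t j j<t with m≤n⇒∃[o]m+o≡n (≤-pred j<t) | half j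
... | v , j+v≡t | m , inj₁ j≡ =
  subst (¬_ ∘ Robinson (3 + t)) (sym (trans (cong (σ (3 + t)) j≡) (σ-even m (suc v) (3 + t) n≡)))
        (subst (λ n → ¬ Robinson n (evenShape m (2 + v))) (sym n≡) (¬robinson-evenShape m v))
  where
  ring : ∀ m v → 3 + (m + m + v) ≡ suc (m + m + (2 + v))
  ring = solve-∀
  n≡ = trans (cong (3 +_) (trans (sym j+v≡t) (cong (_+ v) j≡))) (ring m v)
... | v , j+v≡t | m , inj₂ j≡ =
  subst (¬_ ∘ Robinson (3 + t)) (sym (trans (cong (σ (3 + t)) j≡) (σ-odd m (suc v) (3 + t) n≡)))
        (subst (λ n → ¬ Robinson n (oddShape m (2 + v))) (sym n≡) (¬robinson-oddShape m v))
  where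
  ring : ∀ m v → 3 + (suc (m + m) + v) ≡ suc (suc (m + m + (2 + v)))
  ring = solve-∀
  n≡ = trans (cong (3 +_) (trans (sym j+v≡t) (cong (_+ v) j≡))) (ring m v)

theorem5p10 : (n : ℕ) → 3 ≤ n →
    Robinson n (σ n (n ∸ 2)) × ((j : ℕ) → j < n ∸ 2 → ¬ Robinson n (σ n j))
theorem5p10 1 (s≤s ())
theorem5p10 2 (s≤s (s≤s ()))
theorem5p10 (suc (suc (suc t))) _ = robinson-σ-last t , ¬robinson-σ-early t
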